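{- Let $p$ be a prime, $\nu\in\mathbb{Z}$ and $z\in\mathbb{Q}_p$, and suppose $\mathrm{ord}_p(z)<\nu$ or $z=0$. Then the limit $\mu_p(z,\nu)=\lim_{n\to\infty}F_n(z,\nu)$ exists, and: (i) if $z\in\mathbb{Z}_p$ (where for $z=0$ we take $\nu\ge1$), then $\mu_p(z,\nu)=\dfrac{1}{p^{\nu}+p^{\nu-1}}$; (ii) if $z\notin\mathbb{Z}_p$ with $\mathrm{ord}_p(z)=-\lambda<0$, then $\mu_p(z,\nu)=\dfrac{1}{p^{\nu+2\lambda}+p^{\nu+2\lambda-1}}$; (iii) for $z=0$ and any integer $\nu\ge0$, $\mu_p(0,-\nu)=1-\dfrac{1}{p^{\nu+1}+p^{\nu}}$.
   Context: The Calkin--Wilf tree is the infinite rooted binary tree generated from the root $\frac11$ by giving each vertex labelled $\frac ab$ (reduced) a left child $\frac{a}{a+b}$ and a right child $\frac{a+b}{b}$; its $n$th generation $\mathcal{CW}^{(n)}$ is the multiset of the $2^{n-1}$ labels at distance $n-1$ from the root. For a prime $p$, $z\in\mathbb{Q}_p$ and $\nu\in\mathbb{Z}$, put $F_n(z,\nu)=2^{1-n}\#\{\frac ab\in\mathcal{CW}^{(n)}:\ \mathrm{ord}_p(\frac ab-z)\ge\nu\}$, where $\mathrm{ord}_p$ is the $p$-adic valuation, and $\mu_p(z,\nu)=\lim_{n\to\infty}F_n(z,\nu)$. -}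

module Defs where

open import Data.Nat as ℕ using (ℕ; zero; suc; NonZero)
open import Data.Nat.Properties using (m^n≢0)
open import Data.Nat.Divisibility using (_∣_; _∣?_)
open import Data.Integer as ℤ using (ℤ; +_; -[1+_])
open import Data.Rational as ℚ using (ℚ; _/_; ↥_; ↧ₙ_; 0ℚ; 1ℚ; ∣_∣)
open import Data.Fin using (Fin; toℕ)
open import Data.List using (List; []; _∷_; concatMap; filter; length)
open import Data.Product using (_×_; _,_; Σ; ∃; ∃-syntax)
open import Relation.Nullary using (¬_; Dec; _×-dec_; ¬?)
open import Relation.Binary.PropositionalEquality using (_≡_; _≢_)

-- Calkin–Wilf tree.  A label a/b is stored as the pair (a , b).
-- cwGen n is the (n+1)-st generation CW^(n+1) (a list = multiset of
-- 2^n labels); cwGen 0 = [ 1/1 ].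

cwChildren : ℕ × ℕ → List (ℕ × ℕ)
cwChildren (a , b) = (a , a ℕ.+ b) ∷ (a ℕ.+ b , b) ∷ []

cwGen : ℕ → List (ℕ × ℕ)
cwGen zero    = (1 , 1) ∷ []
cwGen (suc n) = concatMap cwChildren (cwGen n)

-- p-adic valuation on ℚ:  for r = num/den in lowest terms and m ∈ ℤ,
-- ord_p(r) ≥ m (with ord_p 0 = +∞)  iff
--   p^(max m 0) ∣ num   and   ¬ p^(max (-m) 0 + 1) ∣ den.

posPart : ℤ → ℕ
posPart (+ j)     = j
posPart -[1+ j ]  = 0

negPart : ℤ → ℕ
negPart (+ j)     = 0
negPart -[1+ j ]  = suc j

OrdGeℚ : (p : ℕ) → ℚ → ℤ → Set
OrdGeℚ p r m = (p ℕ.^ posPart m ∣ ℤ.∣ ↥ r ∣) × ¬ (p ℕ.^ suc (negPart m) ∣ ↧ₙ r)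

ordGeℚ? : (p : ℕ) → (r : ℚ) → (m : ℤ) → Dec (OrdGeℚ p r m)
ordGeℚ? p r m = (p ℕ.^ posPart m ∣? ℤ.∣ ↥ r ∣) ×-dec ¬? (p ℕ.^ suc (negPart m) ∣? ↧ₙ r)

-- p-adic numbers.  A p-adic integer is its digit sequence
-- u = Σ_{i≥0} d_i p^i with d_i ∈ {0,…,p-1};  a p-adic number is
-- z = p^(-shift) · u.  (Every element of ℚ_p has such a representation.)

record Qp (p : ℕ) : Set where
  constructor mkQp
  field
    shift  : ℕ
    digits : ℕ → Fin p
open Qp public

trunc : {p : ℕ} → (ℕ → Fin p) → ℕ → ℕ
trunc d zero    = 0
trunc {p} d (suc n) = trunc d n ℕ.+ toℕ (d n) ℕ.* p ℕ.^ n

IsZero : {p : ℕ} → Qp p → Set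
IsZero z = ∀ i → toℕ (digits z i) ≡ 0

-- z ∈ ℤ_p   (⇔ p^shift ∣ u ⇔ the first `shift` digits vanish)
InZp : {p : ℕ} → Qp p → Set
InZp z = trunc (digits z) (shift z) ≡ 0

-- ord_p(z) = o   (z ≠ 0; ord_p(u) = j iff u ≡ 0 mod p^j, u ≢ 0 mod p^(j+1))
HasOrd : {p : ℕ} → Qp p → ℤ → Set
HasOrd z o = ∃[ j ] (o ≡ + j ℤ.- + shift z)
                  × (trunc (digits z) j ≡ 0)
                  × (trunc (digits z) (suc j) ≢ 0)

OrdLt : {p : ℕ} → Qp p → ℤ → Set
OrdLt z ν = ∃[ o ] HasOrd z o × (o ℤ.< ν)

-- ord_p(a/b − z) ≥ ν  for a rational a/b (b ≠ 0) and z = p^(-k) u: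
-- with m = ν + k, this is ord_p(p^k a/b − u) ≥ m, and since
-- ord_p(u − (u mod p^(max m 0))) ≥ max m 0 ≥ m, it is equivalent to
-- ord_p((p^k a − b·(u mod p^(max m 0)))/b) ≥ m.
-- (p^k a − b·(u mod p^(max m 0)))/b as a rational (labels always have b ≥ 1)
shiftedDiff : (p : ℕ) → Qp p → ℤ → ℕ × ℕ → ℚ
shiftedDiff p z m (a , zero)      = 0ℚ   -- never used: labels have b ≥ 1
shiftedDiff p z m (a , b@(suc _)) =
  (+ (p ℕ.^ shift z ℕ.* a) ℤ.- + (trunc (digits z) (posPart m) ℕ.* b)) / b

OrdDiffGe : (p : ℕ) → Qp p → ℤ → ℕ × ℕ → Set
OrdDiffGe p z ν ab = OrdGeℚ p (shiftedDiff p z (ν ℤ.+ + shift z) ab) (ν ℤ.+ + shift z)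

ordDiffGe? : (p : ℕ) → (z : Qp p) → (ν : ℤ) → (ab : ℕ × ℕ) → Dec (OrdDiffGe p z ν ab)
ordDiffGe? p z ν ab = ordGeℚ? p (shiftedDiff p z (ν ℤ.+ + shift z) ab) (ν ℤ.+ + shift z)

count : (p : ℕ) → Qp p → ℤ → ℕ → ℕ
count p z ν n = length (filter (ordDiffGe? p z ν) (cwGen n))

-- Fseq p z ν n = F_{n+1}(z, ν) = 2^{-n} · #{…}
Fseq : (p : ℕ) → Qp p → ℤ → ℕ → ℚ
Fseq p z ν n = (+ count p z ν n / (2 ℕ.^ n)) {{m^n≢0 2 n}}

powℚ : (p : ℕ) → .{{NonZero p}} → ℤ → ℚ
powℚ p (+ j)    = + (p ℕ.^ j) / 1
powℚ p -[1+ j ] = (+ 1 / (p ℕ.^ suc j)) {{m^n≢0 p (suc j)}}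

-- 1 / (p^e + p^(e-1)) = p^(1-e) / (p+1)
cwVal : (p : ℕ) → .{{NonZero p}} → ℤ → ℚ
cwVal p e = powℚ p (+ 1 ℤ.- e) ℚ.* (+ 1 / suc p)

ConvergesTo : (ℕ → ℚ) → ℚ → Set
ConvergesTo s L = ∀ (ε : ℚ) → 0ℚ ℚ.< ε → ∃[ N ] ∀ n → N ℕ.≤ n → ∣ s n ℚ.- L ∣ ℚ.< ε

-- Fix M = p^(K+1) with K large enough for the precision ν. For a Calkin-Wilf label a/b in
-- lowest terms, whether ord_p(a/b - z) ≥ ν only depends on (a mod M, b mod M), so F_n is the
-- proportion of the 2^n words in L(a,b) = (a, a+b), R(a,b) = (a+b, b) that carry (1,1) into
-- a fixed set Q of residue pairs. L and R permute the primitive pairs (those not both divisible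
-- by p), and every primitive pair reaches (0,1) within J = 2M+1 steps. Comparing a word through
-- (0,1) with the others, the spread of the counts over primitive starting pairs shrinks by the
-- factor (2^J - 1)/2^J every J steps, while their sum is exactly 2^n |Q ∩ primitive|. Hence F_n
-- tends to the density of Q among the primitive pairs, which is counted in each of the three cases.

module Submission where

open import Defs

module _ where
  open import Data.Nat
  open import Data.Nat.Properties
  open import Data.Nat.DivMod
  open import Data.Nat.Divisibility
  open import Data.Nat.Coprimality using (Coprime; coprime-Bézout; coprime-divisor; recompute)
  open import Data.Nat.GCD using (gcd; module Bézout)
  open import Data.Nat.Primality using (Prime; prime⇒nonZero; prime⇒nonTrivial; prime⇒irreducible; euclidsLemma)
  open import Data.Nat.Solver using (module +-*-Solver)
  open +-*-Solver using (solve; _:=_; con; _:+_; _:*_)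
  open import Data.Bool using (Bool; true; false; not; _∧_)
  open import Data.Bool.Properties using (∧-zeroʳ; ∧-identityʳ)
  open import Data.Fin using (Fin; toℕ)
  open import Data.Fin.Properties using (toℕ<n)
  open import Data.List using (List; []; _∷_; _++_; concat; concatMap; map; filter; length)
  open import Data.List.Properties using (map-++; concat-++; length-++; filter-++)
  open import Data.Product using (∃; _×_; _,_; proj₁; proj₂)
  open import Data.Sum using (_⊎_; inj₁; inj₂)
  open import Function using (_∘_; _⇔_; mk⇔; Equivalence; case_of_)
  open import Function.Properties.Equivalence using (⇔-setoid) renaming (sym to ⇔-sym; trans to ⇔-trans)
  open import Data.Product.Function.NonDependent.Propositional using (_×-⇔_)
  open import Level using (0ℓ)
  import Relation.Binary.Reasoning.Setoid as SetoidReasoning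
  open import Relation.Nullary using (¬_; Dec; does; yes; no; contradiction)
  open import Relation.Nullary.Decidable using (dec-true; dec-false; does-⇔)
  open import Relation.Unary using (Decidable)
  open import Relation.Binary using (tri<; tri≈; tri>)
  open import Relation.Binary.PropositionalEquality
  import Data.Integer as ℤ
  open import Data.Integer using (ℤ; -[1+_]; _⊖_)
  import Data.Integer.Properties as ℤP
  import Data.Integer.Solver as ℤSolver
  import Data.Rational as ℚ
  open import Data.Rational using (ℚ; mkℚ; ↥_; ↧_; ↧ₙ_; 0ℚ; 1ℚ; toℚᵘ)
  import Data.Rational.Properties as ℚP
  import Data.Rational.Unnormalised as ℚᵘ
  open import Data.Rational.Unnormalised using (mkℚᵘ; *≡*; *<*)
  import Data.Rational.Unnormalised.Properties as ℚᵘP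

  𝟙 : Bool → ℕ
  𝟙 true  = 1
  𝟙 false = 0

  ∑ : ℕ → (ℕ → ℕ) → ℕ
  ∑ zero    f = 0
  ∑ (suc n) f = ∑ n f + f n

  syntax ∑ n (λ i → e) = ∑[ i < n ] e

  ∑-cong : ∀ n {f g : ℕ → ℕ} → (∀ i → i < n → f i ≡ g i) → ∑ n f ≡ ∑ n g
  ∑-cong zero    eq = refl
  ∑-cong (suc n) eq = cong₂ _+_ (∑-cong n (λ i i<n → eq i (m<n⇒m<1+n i<n))) (eq n ≤-refl)

  ∑-mono-≤ : ∀ n {f g : ℕ → ℕ} → (∀ i → i < n → f i ≤ g i) → ∑ n f ≤ ∑ n g
  ∑-mono-≤ zero    le = z≤n
  ∑-mono-≤ (suc n) le = +-mono-≤ (∑-mono-≤ n (λ i i<n → le i (m<n⇒m<1+n i<n))) (le n ≤-refl)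

  ∑-distrib-+ : ∀ n (f g : ℕ → ℕ) → ∑[ i < n ] (f i + g i) ≡ ∑ n f + ∑ n g
  ∑-distrib-+ zero    f g = refl
  ∑-distrib-+ (suc n) f g rewrite ∑-distrib-+ n f g =
    solve 4 (λ a b c d → (a :+ b) :+ (c :+ d) := (a :+ c) :+ (b :+ d)) refl (∑ n f) (∑ n g) (f n) (g n)

  ∑-distribˡ-* : ∀ n k (f : ℕ → ℕ) → ∑[ i < n ] (k * f i) ≡ k * ∑ n f
  ∑-distribˡ-* zero    k f = sym (*-zeroʳ k)
  ∑-distribˡ-* (suc n) k f rewrite ∑-distribˡ-* n k f = sym (*-distribˡ-+ k (∑ n f) (f n))

  ∑-distribʳ-* : ∀ n k (f : ℕ → ℕ) → ∑[ i < n ] (f i * k) ≡ ∑ n f * k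
  ∑-distribʳ-* n k f = begin
    ∑[ i < n ] (f i * k)  ≡⟨ ∑-cong n (λ i _ → *-comm (f i) k) ⟩
    ∑[ i < n ] (k * f i)  ≡⟨ ∑-distribˡ-* n k f ⟩
    k * ∑ n f             ≡⟨ *-comm k (∑ n f) ⟩
    ∑ n f * k             ∎
    where open ≡-Reasoning

  ∑-const : ∀ n k → ∑[ _ < n ] k ≡ n * k
  ∑-const zero    k = refl
  ∑-const (suc n) k rewrite ∑-const n k = +-comm (n * k) k

  ∑-sucˡ : ∀ n (f : ℕ → ℕ) → ∑ (suc n) f ≡ f 0 + ∑[ i < n ] f (suc i)
  ∑-sucˡ zero    f = +-comm 0 (f 0)
  ∑-sucˡ (suc n) f rewrite ∑-sucˡ n f = +-assoc (f 0) _ _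

  ∑-swap : ∀ n m (f : ℕ → ℕ → ℕ) → ∑[ i < n ] ∑[ j < m ] f i j ≡ ∑[ j < m ] ∑[ i < n ] f i j
  ∑-swap zero    m f = sym (trans (∑-const m 0) (*-zeroʳ m))
  ∑-swap (suc n) m f rewrite ∑-swap n m f = sym (∑-distrib-+ m (λ j → ∑[ i < n ] f i j) (f n))

  ∑-split : ∀ n r (f : ℕ → ℕ) → ∑ (n + r) f ≡ ∑ n f + ∑[ j < r ] f (n + j)
  ∑-split n zero    f rewrite +-identityʳ n = sym (+-identityʳ _)
  ∑-split n (suc r) f rewrite +-suc n r | ∑-split n r f = +-assoc (∑ n f) _ _

  ∑-blocks : ∀ q r (f : ℕ → ℕ) → ∑ (q * r) f ≡ ∑[ i < q ] ∑[ j < r ] f (i * r + j)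
  ∑-blocks zero    r f = refl
  ∑-blocks (suc q) r f = begin
    ∑ (r + q * r) f                                    ≡⟨ cong (λ k → ∑ k f) (+-comm r (q * r)) ⟩
    ∑ (q * r + r) f                                    ≡⟨ ∑-split (q * r) r f ⟩
    ∑ (q * r) f + ∑[ j < r ] f (q * r + j)             ≡⟨ cong (_+ ∑[ j < r ] f (q * r + j)) (∑-blocks q r f) ⟩
    ∑[ i < q ] ∑[ j < r ] f (i * r + j) + ∑[ j < r ] f (q * r + j) ∎
    where open ≡-Reasoning

  %-distribʳ-+ : ∀ a y M .{{_ : NonZero M}} → (a + y % M) % M ≡ (a + y) % M
  %-distribʳ-+ a y M = begin
    (a + y % M) % M             ≡⟨ %-distribˡ-+ a (y % M) M ⟩
    (a % M + y % M % M) % M     ≡⟨ cong (λ w → (a % M + w) % M) (m%n%n≡m%n y M) ⟩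
    (a % M + y % M) % M         ≡⟨ sym (%-distribˡ-+ a y M) ⟩
    (a + y) % M                 ∎
    where open ≡-Reasoning

  %-distribʳ-* : ∀ a y M .{{_ : NonZero M}} → (a * (y % M)) % M ≡ (a * y) % M
  %-distribʳ-* a y M = begin
    (a * (y % M)) % M           ≡⟨ %-distribˡ-* a (y % M) M ⟩
    (a % M * (y % M % M)) % M   ≡⟨ cong (λ w → (a % M * w) % M) (m%n%n≡m%n y M) ⟩
    (a % M * (y % M)) % M       ≡⟨ sym (%-distribˡ-* a y M) ⟩
    (a * y) % M                 ∎
    where open ≡-Reasoning

  ∑-rotate : ∀ M .{{_ : NonZero M}} a (f : ℕ → ℕ) → ∑[ b < M ] f ((a + b) % M) ≡ ∑ M f
  ∑-rotate M zero    f = ∑-cong M (λ b b<M → cong f (m<n⇒m%n≡m b<M))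
  ∑-rotate M (suc a) f = begin
    ∑[ b < M ] f ((suc a + b) % M)          ≡⟨ ∑-cong M (λ b _ → cong f (step b)) ⟩
    ∑[ b < M ] f ((a + (1 + b) % M) % M)    ≡⟨ rotate-once M (λ y → f ((a + y) % M)) ⟩
    ∑[ y < M ] f ((a + y) % M)              ≡⟨ ∑-rotate M a f ⟩
    ∑ M f                                   ∎
    where
    open ≡-Reasoning

    step : ∀ b → (suc a + b) % M ≡ (a + (1 + b) % M) % M
    step b = trans (cong (_% M) (sym (+-suc a b))) (sym (%-distribʳ-+ a (suc b) M))

    rotate-once : ∀ M .{{_ : NonZero M}} (g : ℕ → ℕ) → ∑[ b < M ] g ((1 + b) % M) ≡ ∑ M g
    rotate-once (suc m) g = begin
      ∑[ b < m ] g ((1 + b) % suc m) + g ((1 + m) % suc m)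
        ≡⟨ cong₂ _+_ (∑-cong m (λ b b<m → cong g (m<n⇒m%n≡m (s≤s b<m)))) (cong g (n%n≡0 (suc m))) ⟩
      ∑[ b < m ] g (suc b) + g 0     ≡⟨ +-comm _ (g 0) ⟩
      g 0 + ∑[ b < m ] g (suc b)     ≡⟨ sym (∑-sucˡ m g) ⟩
      ∑ (suc m) g                    ∎

  𝟙-not : ∀ x → 𝟙 (not x) + 𝟙 x ≡ 1
  𝟙-not true  = refl
  𝟙-not false = refl

  𝟙-∧ : ∀ x y → 𝟙 (x ∧ y) ≡ 𝟙 x * 𝟙 y
  𝟙-∧ true  y = sym (+-identityʳ (𝟙 y))
  𝟙-∧ false y = refl

  ∑-𝟙-not : ∀ n (f : ℕ → Bool) → ∑[ a < n ] 𝟙 (not (f a)) + ∑[ a < n ] 𝟙 (f a) ≡ n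
  ∑-𝟙-not n f = trans (sym (∑-distrib-+ n (λ a → 𝟙 (not (f a))) (λ a → 𝟙 (f a))))
                      (trans (∑-cong n (λ a _ → 𝟙-not (f a))) (trans (∑-const n 1) (*-identityʳ n)))

  ∑-𝟙-≡ : ∀ n c → c < n → ∑[ a < n ] 𝟙 (does (a ≟ c)) ≡ 1
  ∑-𝟙-≡ (suc n) c c<1+n with n ≟ c
  ... | yes refl = cong₂ _+_ (none n ≤-refl) (cong 𝟙 (dec-true (n ≟ n) refl))
    where
    none : ∀ k → k ≤ n → ∑[ a < k ] 𝟙 (does (a ≟ n)) ≡ 0
    none zero    _   = refl
    none (suc k) k<n = cong₂ _+_ (none k (≤-trans (n≤1+n k) k<n)) (cong 𝟙 (dec-false (k ≟ n) (<⇒≢ k<n)))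
  ... | no n≢c = trans (cong (∑[ a < n ] 𝟙 (does (a ≟ c)) +_) (cong 𝟙 (dec-false (n ≟ c) n≢c)))
                       (trans (+-identityʳ _) (∑-𝟙-≡ n c (≤∧≢⇒< (≤-pred c<1+n) (n≢c ∘ sym))))

  ∑-at-0 : ∀ n (f : ℕ → ℕ) → 0 < n → ∑[ b < n ] (f b * 𝟙 (does (b ≟ 0))) ≡ f 0
  ∑-at-0 (suc zero)    f _ = *-identityʳ (f 0)
  ∑-at-0 (suc (suc n)) f _ = trans (cong (∑[ b < suc n ] (f b * 𝟙 (does (b ≟ 0))) +_) (*-zeroʳ (f (suc n))))
                                   (trans (+-identityʳ _) (∑-at-0 (suc n) f (s≤s z≤n)))

  r∣i*r+j⇔j≡0 : ∀ i r j .{{_ : NonZero r}} → j < r → r ∣ i * r + j ⇔ j ≡ 0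
  r∣i*r+j⇔j≡0 i r j j<r = mk⇔
    (λ r∣ → trans (sym (m<n⇒m%n≡m j<r)) (trans (sym (%-remove-+ˡ j (divides i refl))) (n∣m⇒m%n≡0 _ r r∣)))
    (λ { refl → subst (r ∣_) (sym (+-identityʳ (i * r))) (divides i refl) })

  ∑-𝟙-∣ : ∀ q r .{{_ : NonZero r}} → ∑[ a < q * r ] 𝟙 (does (r ∣? a)) ≡ q
  ∑-𝟙-∣ q r = begin
    ∑[ a < q * r ] 𝟙 (does (r ∣? a))                          ≡⟨ ∑-blocks q r _ ⟩
    ∑[ i < q ] ∑[ j < r ] 𝟙 (does (r ∣? (i * r + j)))         ≡⟨ ∑-cong q (λ i _ → trans (∑-cong r (λ j j<r →
                                                                   cong 𝟙 (does-⇔ (r∣i*r+j⇔j≡0 i r j j<r) (r ∣? (i * r + j)) (j ≟ 0))))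
                                                                   (∑-𝟙-≡ r 0 (>-nonZero⁻¹ r))) ⟩
    ∑[ _ < q ] 1                                              ≡⟨ trans (∑-const q 1) (*-identityʳ q) ⟩
    q                                                         ∎
    where open ≡-Reasoning

  ∑-𝟙-∤+q≡q*p : ∀ q p .{{_ : NonZero p}} → ∑[ a < q * p ] 𝟙 (not (does (p ∣? a))) + q ≡ q * p
  ∑-𝟙-∤+q≡q*p q p = trans (cong (∑[ a < q * p ] 𝟙 (not (does (p ∣? a))) +_) (sym (∑-𝟙-∣ q p)))
                          (∑-𝟙-not (q * p) (λ a → does (p ∣? a)))

  toℚᵘ-/ : ∀ i n → toℚᵘ (i ℚ./ suc n) ℚᵘ.≃ mkℚᵘ i n
  toℚᵘ-/ i n = ℚP.toℚᵘ-fromℚᵘ (mkℚᵘ i n)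

  /≡/ : ∀ a b c d .{{_ : NonZero b}} .{{_ : NonZero d}} → a * d ≡ c * b → (ℤ.+ a ℚ./ b) ≡ (ℤ.+ c ℚ./ d)
  /≡/ a (suc b) c (suc d) eq = ℚP.toℚᵘ-injective (ℚᵘP.≃-trans (toℚᵘ-/ (ℤ.+ a) b) (ℚᵘP.≃-trans
    (*≡* (trans (sym (ℤP.pos-* a (suc d))) (trans (cong ℤ.+_ eq) (ℤP.pos-* c (suc b)))))
    (ℚᵘP.≃-sym (toℚᵘ-/ (ℤ.+ c) d))))

  /*/ : ∀ a b c d .{{_ : NonZero b}} .{{_ : NonZero d}} →
    (ℤ.+ a ℚ./ b) ℚ.* (ℤ.+ c ℚ./ d) ≡ (ℤ.+ (a * c) ℚ./ (b * d)) {{m*n≢0 b d}}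
  /*/ a (suc b) c (suc d) = ℚP.toℚᵘ-injective
    (ℚᵘP.≃-trans (ℚP.toℚᵘ-homo-* (ℤ.+ a ℚ./ suc b) (ℤ.+ c ℚ./ suc d))
    (ℚᵘP.≃-trans (ℚᵘP.*-cong (toℚᵘ-/ (ℤ.+ a) b) (toℚᵘ-/ (ℤ.+ c) d))
    (ℚᵘP.≃-trans (*≡* (cong (ℤ._* ℤ.+ (suc b * suc d)) (sym (ℤP.pos-* a c))))
      (ℚᵘP.≃-sym (toℚᵘ-/ (ℤ.+ (a * c)) (pred (suc b * suc d)))))))

  /+/≡1 : ∀ a b c d .{{_ : NonZero b}} .{{_ : NonZero d}} → a * d + c * b ≡ b * d →
    (ℤ.+ a ℚ./ b) ℚ.+ (ℤ.+ c ℚ./ d) ≡ 1ℚ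
  /+/≡1 a (suc b) c (suc d) eq = ℚP.toℚᵘ-injective
    (ℚᵘP.≃-trans (ℚP.toℚᵘ-homo-+ (ℤ.+ a ℚ./ suc b) (ℤ.+ c ℚ./ suc d))
    (ℚᵘP.≃-trans (ℚᵘP.+-cong (toℚᵘ-/ (ℤ.+ a) b) (toℚᵘ-/ (ℤ.+ c) d))
    (*≡* (begin
      (ℤ.+ a ℤ.* ℤ.+ suc d ℤ.+ ℤ.+ c ℤ.* ℤ.+ suc b) ℤ.* ℤ.+ 1 ≡⟨ ℤP.*-identityʳ _ ⟩
      ℤ.+ a ℤ.* ℤ.+ suc d ℤ.+ ℤ.+ c ℤ.* ℤ.+ suc b            ≡⟨ cong₂ ℤ._+_ (sym (ℤP.pos-* a (suc d))) (sym (ℤP.pos-* c (suc b))) ⟩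
      ℤ.+ (a * suc d) ℤ.+ ℤ.+ (c * suc b)                    ≡⟨ sym (ℤP.pos-+ (a * suc d) (c * suc b)) ⟩
      ℤ.+ (a * suc d + c * suc b)                            ≡⟨ cong ℤ.+_ eq ⟩
      ℤ.+ (suc b * suc d)                                    ≡⟨ sym (ℤP.*-identityˡ _) ⟩
      ℤ.+ 1 ℤ.* ℤ.+ (suc b * suc d)                          ∎))))
    where open ≡-Reasoning

  +≡1⇒≡1- : ∀ x y → x ℚ.+ y ≡ 1ℚ → x ≡ 1ℚ ℚ.- y
  +≡1⇒≡1- x y eq = begin
    x                   ≡⟨ sym (ℚP.+-identityʳ x) ⟩
    x ℚ.+ 0ℚ            ≡⟨ cong (x ℚ.+_) (sym (ℚP.+-inverseʳ y)) ⟩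
    x ℚ.+ (y ℚ.- y)     ≡⟨ sym (ℚP.+-assoc x y (ℚ.- y)) ⟩
    (x ℚ.+ y) ℚ.- y     ≡⟨ cong (ℚ._- y) eq ⟩
    1ℚ ℚ.- y            ∎
    where open ≡-Reasoning

  ∣c/D-u/W∣<ε : ∀ (c u D W B : ℕ) .{{_ : NonZero D}} .{{_ : NonZero W}} (ε : ℚ) → 0ℚ ℚ.< ε →
    c * W ≤ u * D + B → u * D ≤ c * W + B → B * ↧ₙ ε < ℤ.∣ ↥ ε ∣ * (D * W) →
    ℚ.∣ (ℤ.+ c ℚ./ D) ℚ.- (ℤ.+ u ℚ./ W) ∣ ℚ.< ε
  ∣c/D-u/W∣<ε c u (suc d) (suc w) B (mkℚ (ℤ.+ n) e _) _ cW≤ uD≤ B*e<n*DW =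
    ℚP.toℚᵘ-cancel-< (ℚᵘP.≤-<-trans (ℚᵘP.≤-reflexive as-ℚᵘ) (*<* (subst₂ ℤ._<_ (ℤP.pos-* K (suc e)) (ℤP.pos-* n (suc d * suc w))
      (ℤ.+<+ (≤-<-trans (*-monoˡ-≤ (suc e) cross≤B) B*e<n*DW)))))
    where
    c/D u/W : ℚ
    c/D = ℤ.+ c ℚ./ suc d
    u/W = ℤ.+ u ℚ./ suc w

    X : ℚᵘ.ℚᵘ
    X = mkℚᵘ (ℤ.+ c) d ℚᵘ.+ ℚᵘ.- mkℚᵘ (ℤ.+ u) w

    as-ℚᵘ : toℚᵘ ℚ.∣ c/D ℚ.- u/W ∣ ℚᵘ.≃ ℚᵘ.∣ X ∣
    as-ℚᵘ = ℚᵘP.≃-trans (ℚP.toℚᵘ-homo-∣-∣ (c/D ℚ.- u/W)) (ℚᵘP.∣-∣-cong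
      (ℚᵘP.≃-trans (ℚP.toℚᵘ-homo-+ c/D (ℚ.- u/W))
        (ℚᵘP.+-cong (toℚᵘ-/ (ℤ.+ c) d) (ℚᵘP.≃-trans (ℚP.toℚᵘ-homo‿- u/W) (ℚᵘP.-‿cong (toℚᵘ-/ (ℤ.+ u) w))))))

    cross : ℤ.+ c ℤ.* ℤ.+ suc w ℤ.+ (ℤ.- ℤ.+ u) ℤ.* ℤ.+ suc d ≡ (c * suc w) ⊖ (u * suc d)
    cross = begin
      ℤ.+ c ℤ.* ℤ.+ suc w ℤ.+ (ℤ.- ℤ.+ u) ℤ.* ℤ.+ suc d
        ≡⟨ cong₂ ℤ._+_ (sym (ℤP.pos-* c (suc w))) (sym (ℤP.neg-distribˡ-* (ℤ.+ u) (ℤ.+ suc d))) ⟩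
      ℤ.+ (c * suc w) ℤ.+ ℤ.- (ℤ.+ u ℤ.* ℤ.+ suc d)
        ≡⟨ cong (λ x → ℤ.+ (c * suc w) ℤ.+ ℤ.- x) (sym (ℤP.pos-* u (suc d))) ⟩
      ℤ.+ (c * suc w) ℤ.- ℤ.+ (u * suc d)
        ≡⟨ ℤP.m-n≡m⊖n (c * suc w) (u * suc d) ⟩
      (c * suc w) ⊖ (u * suc d) ∎
      where open ≡-Reasoning
    K : ℕ
    K = ℤ.∣ ℤ.+ c ℤ.* ℤ.+ suc w ℤ.+ (ℤ.- ℤ.+ u) ℤ.* ℤ.+ suc d ∣

    ∣⊖∣≤ : ∀ x y → x ≤ y + B → y ≤ x + B → ℤ.∣ x ⊖ y ∣ ≤ B
    ∣⊖∣≤ x y x≤ y≤ with ≤-total y x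
    ... | inj₁ y≤x rewrite ℤP.⊖-≥ y≤x = m≤n+o⇒m∸n≤o x y x≤
    ... | inj₂ x≤y rewrite ℤP.⊖-≤ x≤y | ℤP.∣-i∣≡∣i∣ (ℤ.+ (y ∸ x)) = m≤n+o⇒m∸n≤o y x y≤

    cross≤B : K ≤ B
    cross≤B rewrite cross = ∣⊖∣≤ (c * suc w) (u * suc d) cW≤ uD≤
  ∣c/D-u/W∣<ε c u (suc d) (suc w) B (mkℚ -[1+ n ] e _) (ℚ.*<* ()) _ _ _

  A^t*[A+t]≤A*[1+A]^t : ∀ A t → A ^ t * (A + t) ≤ A * suc A ^ t
  A^t*[A+t]≤A*[1+A]^t A zero = ≤-reflexive (trans (+-identityʳ (A + 0)) (trans (+-identityʳ A) (sym (*-identityʳ A))))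
  A^t*[A+t]≤A*[1+A]^t A (suc t) = begin
    A * A ^ t * (A + suc t)              ≡⟨ solve 3 (λ a x t → a :* x :* (a :+ (con 1 :+ t)) := a :* (x :* (a :+ t)) :+ a :* x) refl A (A ^ t) t ⟩
    A * (A ^ t * (A + t)) + A * A ^ t    ≤⟨ +-mono-≤ (*-monoʳ-≤ A (A^t*[A+t]≤A*[1+A]^t A t)) (*-monoʳ-≤ A (^-monoˡ-≤ t (n≤1+n A))) ⟩
    A * (A * suc A ^ t) + A * suc A ^ t  ≡⟨ solve 2 (λ a y → a :* (a :* y) :+ a :* y := a :* ((con 1 :+ a) :* y)) refl A (suc A ^ t) ⟩
    A * (suc A * suc A ^ t)              ∎
    where open ≤-Reasoning

  -- (A/(A+1))^t → 0: below 1/k as soon as t > k A.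
  A^t*k<[1+A]^t : ∀ A k t → k * A < t → A ^ t * k < suc A ^ t
  A^t*k<[1+A]^t A k t kA<t = *-cancelʳ-< (A + t) (A ^ t * k) (suc A ^ t) (begin-strict
    A ^ t * k * (A + t)      ≡⟨ solve 3 (λ x e y → x :* e :* y := e :* (x :* y)) refl (A ^ t) k (A + t) ⟩
    k * (A ^ t * (A + t))    ≤⟨ *-monoʳ-≤ k (A^t*[A+t]≤A*[1+A]^t A t) ⟩
    k * (A * suc A ^ t)      ≡⟨ sym (*-assoc k A (suc A ^ t)) ⟩
    k * A * suc A ^ t        <⟨ *-monoˡ-< (suc A ^ t) {{m^n≢0 (suc A) t}} (≤-trans kA<t (m≤n+m t A)) ⟩
    (A + t) * suc A ^ t      ≡⟨ *-comm (A + t) (suc A ^ t) ⟩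
    suc A ^ t * (A + t)      ∎)
    where open ≤-Reasoning

  converges-from-window : ∀ J .{{_ : NonZero J}} A → suc A ≡ 2 ^ J →
    ∀ (f : ℕ → ℕ) s N .{{N≢0 : NonZero N}} →
    (∀ t r → let n = t * J + r ; W = N * (A ^ t * 2 ^ r) in
             f n * N ≤ 2 ^ n * s + W × 2 ^ n * s ≤ f n * N + W) →
    ConvergesTo (λ n → (ℤ.+ f n ℚ./ (2 ^ n)) {{m^n≢0 2 n}}) (ℤ.+ s ℚ./ N)
  converges-from-window J A 1+A≡2^J f s N {{N≢0}} window ε@(mkℚ (ℤ.+ suc k) e-1 _) ε>0 =
    T * J , λ n T*J≤n → close n (subst (_≤ n / J) (m*n/n≡m T J) (/-monoˡ-≤ J T*J≤n))
    where
    T : ℕ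
    T = suc (suc e-1 * A)


    close : ∀ n → T ≤ n / J → ℚ.∣ (ℤ.+ f n ℚ./ (2 ^ n)) {{m^n≢0 2 n}} ℚ.- (ℤ.+ s ℚ./ N) ∣ ℚ.< ε
    close n T≤t = subst (λ m → ℚ.∣ (ℤ.+ f m ℚ./ (2 ^ m)) {{m^n≢0 2 m}} ℚ.- (ℤ.+ s ℚ./ N) ∣ ℚ.< ε) (sym n≡tJ+r)
        (∣c/D-u/W∣<ε (f m) s (2 ^ m) N W {{m^n≢0 2 m}} ε ε>0
          (subst (λ x → f m * N ≤ x + W) (*-comm (2 ^ m) s) (proj₁ (window t r)))
          (subst (_≤ f m * N + W) (*-comm (2 ^ m) s) (proj₂ (window t r)))
          W*e<k*2^m*N)
      where
      t r m : ℕ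
      t = n / J
      r = n % J
      m = t * J + r

      n≡tJ+r : n ≡ m
      n≡tJ+r = trans (m≡m%n+[m/n]*n n J) (+-comm r (t * J))

      W : ℕ
      W = N * (A ^ t * 2 ^ r)

      2^m≡ : 2 ^ m ≡ suc A ^ t * 2 ^ r
      2^m≡ = begin
        2 ^ (t * J + r)        ≡⟨ ^-distribˡ-+-* 2 (t * J) r ⟩
        2 ^ (t * J) * 2 ^ r    ≡⟨ cong (λ x → 2 ^ x * 2 ^ r) (*-comm t J) ⟩
        2 ^ (J * t) * 2 ^ r    ≡⟨ cong (_* 2 ^ r) (sym (^-*-assoc 2 J t)) ⟩
        (2 ^ J) ^ t * 2 ^ r    ≡⟨ cong (λ x → x ^ t * 2 ^ r) (sym 1+A≡2^J) ⟩
        suc A ^ t * 2 ^ r      ∎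
        where open ≡-Reasoning

      W*e<k*2^m*N : W * suc e-1 < suc k * (2 ^ m * N)
      W*e<k*2^m*N = begin-strict
        N * (A ^ t * 2 ^ r) * suc e-1      ≡⟨ solve 4 (λ n x y e → n :* (x :* y) :* e := (x :* e) :* (n :* y)) refl N (A ^ t) (2 ^ r) (suc e-1) ⟩
        (A ^ t * suc e-1) * (N * 2 ^ r)    <⟨ *-monoˡ-< (N * 2 ^ r) {{m*n≢0 N (2 ^ r) {{N≢0}} {{m^n≢0 2 r}}}} (A^t*k<[1+A]^t A (suc e-1) t T≤t) ⟩
        suc A ^ t * (N * 2 ^ r)            ≤⟨ m≤n*m (suc A ^ t * (N * 2 ^ r)) (suc k) ⟩
        suc k * (suc A ^ t * (N * 2 ^ r))  ≡⟨ cong (suc k *_) (solve 3 (λ x n y → x :* (n :* y) := (x :* y) :* n) refl (suc A ^ t) N (2 ^ r)) ⟩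
        suc k * (suc A ^ t * 2 ^ r * N)    ≡⟨ cong (λ x → suc k * (x * N)) (sym 2^m≡) ⟩
        suc k * (2 ^ m * N)                ∎
        where open ≤-Reasoning
  converges-from-window J A _ f s N _ (mkℚ -[1+ _ ] _ _) (ℚ.*<* ())
  converges-from-window J A _ f s N _ (mkℚ (ℤ.+ zero) _ _) (ℚ.*<* (ℤ.+<+ ()))

  cwFrom : ℕ × ℕ → ℕ → List (ℕ × ℕ)
  cwFrom x       zero    = x ∷ []
  cwFrom (a , b) (suc n) = cwFrom (a , a + b) n ++ cwFrom (a + b , b) n

  cwGen≡cwFrom : ∀ n → cwGen n ≡ cwFrom (1 , 1) n
  cwGen≡cwFrom zero    = refl
  cwGen≡cwFrom (suc n) rewrite cwGen≡cwFrom n = children (1 , 1) n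
    where
    concatMap-++ : ∀ {A B : Set} (f : A → List B) xs ys → concatMap f (xs ++ ys) ≡ concatMap f xs ++ concatMap f ys
    concatMap-++ f xs ys = trans (cong concat (map-++ f xs ys)) (sym (concat-++ (map f xs) (map f ys)))

    children : ∀ x n → concatMap cwChildren (cwFrom x n) ≡ cwFrom x (suc n)
    children (a , b) zero    = refl
    children (a , b) (suc n) = trans (concatMap-++ cwChildren (cwFrom (a , a + b) n) (cwFrom (a + b , b) n))
                                     (cong₂ _++_ (children (a , a + b) n) (children (a + b , b) n))

  CWLabel : ℕ × ℕ → Set
  CWLabel (a , b) = Coprime a b × 0 < a × 0 < b

  cwLabel-left : ∀ a b → CWLabel (a , b) → CWLabel (a , a + b)
  cwLabel-left a b (cop , a>0 , b>0) =
    (λ (d∣a , d∣a+b) → cop (d∣a , ∣m+n∣m⇒∣n d∣a+b d∣a)) , a>0 , ≤-trans b>0 (m≤n+m b a)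

  cwLabel-right : ∀ a b → CWLabel (a , b) → CWLabel (a + b , b)
  cwLabel-right a b (cop , a>0 , b>0) =
    (λ {d} (d∣a+b , d∣b) → cop (∣m+n∣m⇒∣n (subst (d ∣_) (+-comm a b) d∣a+b) d∣b , d∣b)) , ≤-trans a>0 (m≤m+n a b) , b>0

  cwLabel-root : CWLabel (1 , 1)
  cwLabel-root = (λ (d∣1 , _) → ∣1⇒≡1 d∣1) , s≤s z≤n , s≤s z≤n

  module Walk (M : ℕ) .{{_ : NonZero M}} (prim : ℕ × ℕ → Bool)
    (prim-left  : ∀ a b → a < M → b < M → prim (a , (a + b) % M) ≡ prim (a , b))
    (prim-right : ∀ a b → a < M → b < M → prim ((a + b) % M , b) ≡ prim (a , b))
    where

    left right : ℕ × ℕ → ℕ × ℕ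
    left  (a , b) = (a , (a + b) % M)
    right (a , b) = ((a + b) % M , b)

    ∑² : (ℕ × ℕ → ℕ) → ℕ
    ∑² h = ∑[ a < M ] ∑[ b < M ] h (a , b)

    ∑²-cong : ∀ {h g} → (∀ a b → a < M → b < M → h (a , b) ≡ g (a , b)) → ∑² h ≡ ∑² g
    ∑²-cong eq = ∑-cong M (λ a a< → ∑-cong M (λ b b< → eq a b a< b<))

    ∑²-mono-≤ : ∀ {h g} → (∀ a b → a < M → b < M → h (a , b) ≤ g (a , b)) → ∑² h ≤ ∑² g
    ∑²-mono-≤ le = ∑-mono-≤ M (λ a a< → ∑-mono-≤ M (λ b b< → le a b a< b<))

    ∑²-distrib-+ : ∀ h g → ∑² (λ y → h y + g y) ≡ ∑² h + ∑² g
    ∑²-distrib-+ h g = trans (∑-cong M (λ a _ → ∑-distrib-+ M (λ b → h (a , b)) (λ b → g (a , b))))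
                             (∑-distrib-+ M (λ a → ∑[ b < M ] h (a , b)) (λ a → ∑[ b < M ] g (a , b)))

    ∑²-distribʳ-* : ∀ k h → ∑² (λ y → h y * k) ≡ ∑² h * k
    ∑²-distribʳ-* k h = trans (∑-cong M (λ a _ → ∑-distribʳ-* M k (λ b → h (a , b))))
                              (∑-distribʳ-* M k (λ a → ∑[ b < M ] h (a , b)))

    ∑²-left : ∀ h → ∑² (λ y → h (left y)) ≡ ∑² h
    ∑²-left h = ∑-cong M (λ a _ → ∑-rotate M a (λ b → h (a , b)))

    ∑²-right : ∀ h → ∑² (λ y → h (right y)) ≡ ∑² h
    ∑²-right h = begin
      ∑[ a < M ] ∑[ b < M ] h ((a + b) % M , b)   ≡⟨ ∑-swap M M (λ a b → h ((a + b) % M , b)) ⟩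
      ∑[ b < M ] ∑[ a < M ] h ((a + b) % M , b)   ≡⟨ ∑-cong M (λ b _ → rotated b) ⟩
      ∑[ b < M ] ∑[ a < M ] h (a , b)             ≡⟨ sym (∑-swap M M (λ a b → h (a , b))) ⟩
      ∑² h                                        ∎
      where
      open ≡-Reasoning

      rotated : ∀ b → ∑[ a < M ] h ((a + b) % M , b) ≡ ∑[ a < M ] h (a , b)
      rotated b = trans (∑-cong M (λ a _ → cong (λ w → h (w % M , b)) (+-comm a b)))
                        (∑-rotate M b (λ a → h (a , b)))

    Primitive : ℕ × ℕ → Set
    Primitive (a , b) = a < M × b < M × prim (a , b) ≡ true

    primitive-left : ∀ y → Primitive y → Primitive (left y)
    primitive-left (a , b) (a< , b< , pr) = a< , m%n<n (a + b) M , trans (prim-left a b a< b<) pr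

    primitive-right : ∀ y → Primitive y → Primitive (right y)
    primitive-right (a , b) (a< , b< , pr) = m%n<n (a + b) M , b< , trans (prim-right a b a< b<) pr

    Reaches : ℕ × ℕ → ℕ × ℕ → ℕ → Set
    Reaches e y zero    = y ≡ e
    Reaches e y (suc j) = Reaches e (left y) j ⊎ Reaches e (right y) j

    2^-1 : ℕ → ℕ
    2^-1 zero    = 0
    2^-1 (suc j) = 2^-1 j + 2 ^ j

    suc[2^-1] : ∀ j → suc (2^-1 j) ≡ 2 ^ j
    suc[2^-1] zero    = refl
    suc[2^-1] (suc j) rewrite sym (suc[2^-1] j) = cong suc (cong (2^-1 j +_) (sym (+-identityʳ (suc (2^-1 j)))))

    #primitive : ℕ
    #primitive = ∑² (λ y → 𝟙 (prim y))

    module Hitting (Q : ℕ × ℕ → Bool) where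

      hits : ℕ → ℕ × ℕ → ℕ
      hits zero    y = 𝟙 (Q y)
      hits (suc n) y = hits n (left y) + hits n (right y)

      total : ℕ → ℕ
      total n = ∑² (λ y → 𝟙 (prim y) * hits n y)

      total-suc : ∀ n → total (suc n) ≡ 2 * total n
      total-suc n = begin
        ∑² (λ y → 𝟙 (prim y) * (hits n (left y) + hits n (right y)))
          ≡⟨ ∑²-cong (λ a b a< b< → trans (*-distribˡ-+ (𝟙 (prim (a , b))) _ _)
               (cong₂ _+_ (cong (λ w → 𝟙 w * hits n (left (a , b))) (sym (prim-left a b a< b<)))
                          (cong (λ w → 𝟙 w * hits n (right (a , b))) (sym (prim-right a b a< b<))))) ⟩
        ∑² (λ y → 𝟙 (prim (left y)) * hits n (left y) + 𝟙 (prim (right y)) * hits n (right y))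
          ≡⟨ ∑²-distrib-+ (λ y → 𝟙 (prim (left y)) * hits n (left y)) (λ y → 𝟙 (prim (right y)) * hits n (right y)) ⟩
        ∑² (λ y → 𝟙 (prim (left y)) * hits n (left y)) + ∑² (λ y → 𝟙 (prim (right y)) * hits n (right y))
          ≡⟨ cong₂ _+_ (∑²-left (λ y → 𝟙 (prim y) * hits n y)) (∑²-right (λ y → 𝟙 (prim y) * hits n y)) ⟩
        total n + total n
          ≡⟨ cong (total n +_) (sym (+-identityʳ (total n))) ⟩
        2 * total n ∎
        where open ≡-Reasoning

      total≡2^n*total0 : ∀ n → total n ≡ 2 ^ n * total 0
      total≡2^n*total0 zero    = sym (+-identityʳ (total 0))
      total≡2^n*total0 (suc n) rewrite total-suc n | total≡2^n*total0 n = sym (*-assoc 2 (2 ^ n) (total 0))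

      hits≤2^n : ∀ n y → hits n y ≤ 2 ^ n
      hits≤2^n zero    y with Q y
      ... | true  = ≤-refl
      ... | false = z≤n
      hits≤2^n (suc n) y = subst (hits (suc n) y ≤_) (cong (2 ^ n +_) (sym (+-identityʳ (2 ^ n))))
                             (+-mono-≤ (hits≤2^n n (left y)) (hits≤2^n n (right y)))

      Bounded : ℕ → ℕ → ℕ → Set
      Bounded n L U = ∀ y → Primitive y → L ≤ hits n y × hits n y ≤ U

      private
        2^[1+j]*k : ∀ j k → 2 ^ suc j * k ≡ 2 ^ j * k + 2 ^ j * k
        2^[1+j]*k j k = solve 2 (λ x k → (con 2 :* x) :* k := x :* k :+ x :* k) refl (2 ^ j) k

      bounded-* : ∀ n L U → Bounded n L U → ∀ j → Bounded (j + n) (2 ^ j * L) (2 ^ j * U)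
      bounded-* n L U B zero    y g rewrite +-identityʳ L | +-identityʳ U = B y g
      bounded-* n L U B (suc j) y g =
        let (l₁ , u₁) = bounded-* n L U B j (left y) (primitive-left y g)
            (l₂ , u₂) = bounded-* n L U B j (right y) (primitive-right y g)
        in subst (_≤ hits (suc j + n) y) (sym (2^[1+j]*k j L)) (+-mono-≤ l₁ l₂)
         , subst (hits (suc j + n) y ≤_) (sym (2^[1+j]*k j U)) (+-mono-≤ u₁ u₂)

      -- Along a word to e the count is exactly hits n e; the 2^j - 1 other words stay within [L, U].
      bounded-via : ∀ e n L U → Bounded n L U → ∀ j y → Primitive y → Reaches e y j →
        hits n e + 2^-1 j * L ≤ hits (j + n) y × hits (j + n) y ≤ hits n e + 2^-1 j * U
      bounded-via e n L U B zero y g refl = ≤-reflexive (+-identityʳ _) , ≤-reflexive (sym (+-identityʳ _))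
      bounded-via e n L U B (suc j) y g (inj₁ r) =
        let (l₁ , u₁) = bounded-via e n L U B j (left y) (primitive-left y g) r
            (l₂ , u₂) = bounded-* n L U B j (right y) (primitive-right y g)
        in subst (_≤ hits (suc j + n) y) (regroup L) (+-mono-≤ l₁ l₂)
         , subst (hits (suc j + n) y ≤_) (regroup U) (+-mono-≤ u₁ u₂)
        where
        regroup : ∀ X → hits n e + 2^-1 j * X + 2 ^ j * X ≡ hits n e + 2^-1 (suc j) * X
        regroup X = solve 4 (λ h a t x → h :+ a :* x :+ t :* x := h :+ (a :+ t) :* x) refl (hits n e) (2^-1 j) (2 ^ j) X
      bounded-via e n L U B (suc j) y g (inj₂ r) =
        let (l₁ , u₁) = bounded-* n L U B j (left y) (primitive-left y g)
            (l₂ , u₂) = bounded-via e n L U B j (right y) (primitive-right y g) r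
        in subst (_≤ hits (suc j + n) y) (regroup L) (+-mono-≤ l₁ l₂)
         , subst (hits (suc j + n) y ≤_) (regroup U) (+-mono-≤ u₁ u₂)
        where
        regroup : ∀ X → 2 ^ j * X + (hits n e + 2^-1 j * X) ≡ hits n e + 2^-1 (suc j) * X
        regroup X = solve 4 (λ h a t x → t :* x :+ (h :+ a :* x) := h :+ (a :+ t) :* x) refl (hits n e) (2^-1 j) (2 ^ j) X

      module Mixing (e : ℕ × ℕ) (J : ℕ) (reaches : ∀ y → Primitive y → Reaches e y J) where

        bounded-window : ∀ t r → ∃ λ L → Bounded (t * J + r) L (L + 2^-1 J ^ t * 2 ^ r)
        bounded-window zero r =
          0 , λ y _ → z≤n , subst (hits r y ≤_) (sym (+-identityʳ (2 ^ r))) (hits≤2^n r y)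
        bounded-window (suc t) r =
          let (L , B) = bounded-window t r
              n = t * J + r
              W = 2^-1 J ^ t * 2 ^ r
              L′ = hits n e + 2^-1 J * L
              B′ : Bounded (J + n) L′ (hits n e + 2^-1 J * (L + W))
              B′ y g = bounded-via e n L (L + W) B J y g (reaches y g)
              index : J + n ≡ suc t * J + r
              index = sym (+-assoc J (t * J) r)
              width : hits n e + 2^-1 J * (L + W) ≡ L′ + 2^-1 J ^ suc t * 2 ^ r
              width = solve 5 (λ h a l x y → h :+ a :* (l :+ x :* y) := (h :+ a :* l) :+ (a :* x) :* y) refl
                        (hits n e) (2^-1 J) L (2^-1 J ^ t) (2 ^ r)
          in L′ , subst₂ (λ k U → Bounded k L′ U) index width B′

        total-bounded : ∀ n L U → Bounded n L U →
          #primitive * L ≤ total n × total n ≤ #primitive * U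
        total-bounded n L U B = subst (_≤ total n) (scaled L) (∑²-mono-≤ (λ a b a< b< → lower a b a< b<))
                           , subst (total n ≤_) (scaled U) (∑²-mono-≤ (λ a b a< b< → upper a b a< b<))
          where
          scaled : ∀ X → ∑² (λ y → 𝟙 (prim y) * X) ≡ #primitive * X
          scaled X = ∑²-distribʳ-* X (λ y → 𝟙 (prim y))
          lower : ∀ a b → a < M → b < M → 𝟙 (prim (a , b)) * L ≤ 𝟙 (prim (a , b)) * hits n (a , b)
          lower a b a< b< with prim (a , b) in eq
          ... | true  = *-monoʳ-≤ 1 (proj₁ (B (a , b) (a< , b< , eq)))
          ... | false = z≤n
          upper : ∀ a b → a < M → b < M → 𝟙 (prim (a , b)) * hits n (a , b) ≤ 𝟙 (prim (a , b)) * U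
          upper a b a< b< with prim (a , b) in eq
          ... | true  = *-monoʳ-≤ 1 (proj₂ (B (a , b) (a< , b< , eq)))
          ... | false = z≤n

        -- Both hits n y * #primitive and total n = 2^n * total 0 lie in the window of width
        -- #primitive * W around #primitive * L.
        hits≈average : ∀ y → Primitive y → ∀ t r →
          let n = t * J + r ; W = #primitive * (2^-1 J ^ t * 2 ^ r) in
          hits n y * #primitive ≤ 2 ^ n * total 0 + W × 2 ^ n * total 0 ≤ hits n y * #primitive + W
        hits≈average y g t r = upper , lower
          where
          n W L N : ℕ
          n = t * J + r
          W = 2^-1 J ^ t * 2 ^ r
          L = proj₁ (bounded-window t r)
          N = #primitive

          B : Bounded n L (L + W)
          B = proj₂ (bounded-window t r)

          total-bounds : N * L ≤ total n × total n ≤ N * (L + W)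
          total-bounds = total-bounded n L (L + W) B

          total-low : N * L ≤ 2 ^ n * total 0
          total-low = subst (N * L ≤_) (total≡2^n*total0 n) (proj₁ total-bounds)
          total-high : 2 ^ n * total 0 ≤ N * (L + W)
          total-high = subst (_≤ N * (L + W)) (total≡2^n*total0 n) (proj₂ total-bounds)
          upper : hits n y * N ≤ 2 ^ n * total 0 + N * W
          upper = begin
            hits n y * N    ≤⟨ *-monoˡ-≤ N (proj₂ (B y g)) ⟩
            (L + W) * N     ≡⟨ solve 3 (λ l w k → (l :+ w) :* k := k :* l :+ k :* w) refl L W N ⟩
            N * L + N * W   ≤⟨ +-monoˡ-≤ (N * W) total-low ⟩
            2 ^ n * total 0 + N * W ∎
            where open ≤-Reasoning
          lower : 2 ^ n * total 0 ≤ hits n y * N + N * W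
          lower = begin
            2 ^ n * total 0 ≤⟨ total-high ⟩
            N * (L + W)     ≡⟨ *-distribˡ-+ N L W ⟩
            N * L + N * W   ≤⟨ +-monoˡ-≤ (N * W) (subst (_≤ hits n y * N) (*-comm L N) (*-monoˡ-≤ N (proj₁ (B y g)))) ⟩
            hits n y * N + N * W ∎
            where open ≤-Reasoning

      reduce : ℕ × ℕ → ℕ × ℕ
      reduce (a , b) = (a % M , b % M)

      module _ {P : ℕ × ℕ → Set} (P? : Decidable P)
               (P⇔Q : ∀ a b → CWLabel (a , b) → P (a , b) ⇔ (Q (a % M , b % M) ≡ true)) where

        #filter≡hits : ∀ n x → CWLabel x → length (filter P? (cwFrom x n)) ≡ hits n (reduce x)
        #filter≡hits zero (a , b) lab with P? (a , b) | Q (a % M , b % M) in eq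
        ... | yes Pab | true  = refl
        ... | yes Pab | false = contradiction (trans (sym eq) (Equivalence.to (P⇔Q a b lab) Pab)) λ ()
        ... | no ¬Pab | true  = contradiction (Equivalence.from (P⇔Q a b lab) eq) ¬Pab
        ... | no ¬Pab | false = refl
        #filter≡hits (suc n) (a , b) lab = begin
          length (filter P? (cwFrom (a , a + b) n ++ cwFrom (a + b , b) n))
            ≡⟨ cong length (filter-++ P? (cwFrom (a , a + b) n) (cwFrom (a + b , b) n)) ⟩
          length (filter P? (cwFrom (a , a + b) n) ++ filter P? (cwFrom (a + b , b) n))
            ≡⟨ length-++ (filter P? (cwFrom (a , a + b) n)) ⟩
          length (filter P? (cwFrom (a , a + b) n)) + length (filter P? (cwFrom (a + b , b) n))
            ≡⟨ cong₂ _+_ (trans (#filter≡hits n (a , a + b) (cwLabel-left a b lab)) (cong (λ w → hits n (a % M , w)) (%-distribˡ-+ a b M)))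
                         (trans (#filter≡hits n (a + b , b) (cwLabel-right a b lab)) (cong (λ w → hits n (w , b % M)) (%-distribˡ-+ a b M))) ⟩
          hits (suc n) (a % M , b % M) ∎
          where open ≡-Reasoning

  prime>1 : ∀ {p} → Prime p → 1 < p
  prime>1 {p} pr = nonTrivial⇒n>1 p {{prime⇒nonTrivial pr}}

  ¬∣⇒coprime-^ : ∀ {p} → Prime p → ∀ K {a} → ¬ p ∣ a → Coprime a (p ^ K)
  ¬∣⇒coprime-^ {p} pr K ¬p∣a {d} (d∣a , d∣p^K) = unit-divisor K (λ p∣d → ¬p∣a (∣-trans p∣d d∣a)) d∣p^K
    where
    unit-divisor : ∀ K {d} → ¬ p ∣ d → d ∣ p ^ K → d ≡ 1
    unit-divisor zero    ¬p∣d d∣1 = ∣1⇒≡1 d∣1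
    unit-divisor (suc K) {d} ¬p∣d d∣ = unit-divisor K ¬p∣d (coprime-divisor d⊥p d∣)
      where
      d⊥p : Coprime d p
      d⊥p {e} (e∣d , e∣p) with prime⇒irreducible pr e∣p
      ... | inj₁ e≡1 = e≡1
      ... | inj₂ refl = contradiction e∣d ¬p∣d

  module PrimePower (p : ℕ) (prime : Prime p) (K : ℕ) where

    instance
      p≢0 : NonZero p
      p≢0 = prime⇒nonZero prime

    M : ℕ
    M = p ^ suc K

    instance
      M≢0 : NonZero M
      M≢0 = m^n≢0 p (suc K)

    1<M : 1 < M
    1<M = ≤-trans (prime>1 prime) (subst (_≤ M) (*-identityʳ p) (*-monoʳ-≤ p (m^n>0 p K)))

    1%M≡1 : 1 % M ≡ 1
    1%M≡1 = m<n⇒m%n≡m 1<M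

    p∣M : p ∣ M
    p∣M = divides (p ^ K) (*-comm p (p ^ K))

    p∣x%M⇔p∣x : ∀ x → p ∣ x % M ⇔ p ∣ x
    p∣x%M⇔p∣x x = mk⇔ (∣n∣m%n⇒∣m p∣M) (λ p∣x → %-presˡ-∣ p∣x p∣M)

    primitive? : ℕ × ℕ → Bool
    primitive? (a , b) = not (does (p ∣? a) ∧ does (p ∣? b))

    primitive?-left : ∀ a b → a < M → b < M → primitive? (a , (a + b) % M) ≡ primitive? (a , b)
    primitive?-left a b _ _ with p ∣? a
    ... | no  _   = refl
    ... | yes p∣a = cong not (does-⇔ (mk⇔
            (λ h → ∣m+n∣m⇒∣n (Equivalence.to (p∣x%M⇔p∣x (a + b)) h) p∣a)
            (λ h → Equivalence.from (p∣x%M⇔p∣x (a + b)) (∣m∣n⇒∣m+n p∣a h))) (p ∣? ((a + b) % M)) (p ∣? b))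

    primitive?-right : ∀ a b → a < M → b < M → primitive? ((a + b) % M , b) ≡ primitive? (a , b)
    primitive?-right a b _ _ with p ∣? b
    ... | no  _   = cong not (trans (∧-zeroʳ _) (sym (∧-zeroʳ _)))
    ... | yes p∣b = cong (λ w → not (w ∧ true)) (does-⇔ (mk⇔
            (λ h → ∣m+n∣m⇒∣n (subst (p ∣_) (+-comm a b) (Equivalence.to (p∣x%M⇔p∣x (a + b)) h)) p∣b)
            (λ h → Equivalence.from (p∣x%M⇔p∣x (a + b)) (∣m∣n⇒∣m+n h p∣b))) (p ∣? ((a + b) % M)) (p ∣? a))

    open Walk M primitive? primitive?-left primitive?-right public

    inverse : ∀ a → ¬ p ∣ a → ∃ λ k → (k * a) % M ≡ 1
    inverse a ¬p∣a with coprime-Bézout (¬∣⇒coprime-^ prime (suc K) ¬p∣a)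
    ... | Bézout.Identity.+- x y eq = x , (begin
          (x * a) % M       ≡⟨ cong (_% M) (sym eq) ⟩
          (1 + y * M) % M   ≡⟨ [m+kn]%n≡m%n 1 y M ⟩
          1 % M             ≡⟨ 1%M≡1 ⟩
          1                 ∎)
      where open ≡-Reasoning
    -- Here x a ≡ -1 (mod M), so x² a² ≡ 1.
    ... | Bézout.Identity.-+ x y eq = x * x * a , (begin
          (x * x * a * a) % M                   ≡⟨ cong (_% M) (solve 2 (λ x a → x :* x :* a :* a := (x :* a) :* (x :* a)) refl x a) ⟩
          (t * t) % M                           ≡⟨ sym ([m+kn]%n≡m%n (t * t) (2 * y) M) ⟩
          (t * t + 2 * y * M) % M               ≡⟨ cong (_% M) square ⟩
          (1 + (y * (y * M)) * M) % M           ≡⟨ [m+kn]%n≡m%n 1 (y * (y * M)) M ⟩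
          1 % M                                 ≡⟨ 1%M≡1 ⟩
          1                                     ∎)
      where
      open ≡-Reasoning
      t : ℕ
      t = x * a

      square : t * t + 2 * y * M ≡ 1 + (y * (y * M)) * M
      square = begin
        t * t + 2 * y * M       ≡⟨ cong (t * t +_) (*-assoc 2 y M) ⟩
        t * t + 2 * (y * M)     ≡⟨ cong (λ w → t * t + 2 * w) (sym eq) ⟩
        t * t + 2 * (1 + t)     ≡⟨ solve 1 (λ t → t :* t :+ con 2 :* (con 1 :+ t) := con 1 :+ (con 1 :+ t) :* (con 1 :+ t)) refl t ⟩
        1 + (1 + t) * (1 + t)   ≡⟨ cong (λ w → 1 + w * w) eq ⟩
        1 + (y * M) * (y * M)   ≡⟨ cong (1 +_) (solve 2 (λ y m → (y :* m) :* (y :* m) := (y :* (y :* m)) :* m) refl y M) ⟩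
        1 + (y * (y * M)) * M   ∎

    solve-b+ka≡1 : ∀ a b → ¬ p ∣ a → b < M → ∃ λ k → k < M × (b + k * a) % M ≡ 1
    solve-b+ka≡1 a b ¬p∣a b<M = (i * c) % M , m%n<n (i * c) M , (begin
      (b + ((i * c) % M) * a) % M           ≡⟨ sym (%-distribʳ-+ b (((i * c) % M) * a) M) ⟩
      (b + (((i * c) % M) * a) % M) % M     ≡⟨ cong (λ w → (b + w) % M) (%-distribˡ-*′ (i * c) a) ⟩
      (b + ((i * c) * a) % M) % M           ≡⟨ cong (λ w → (b + w % M) % M) (solve 3 (λ i c a → (i :* c) :* a := (i :* a) :* c) refl i c a) ⟩
      (b + ((i * a) * c) % M) % M           ≡⟨ cong (λ w → (b + w) % M) (sym (%-distribˡ-*′ (i * a) c)) ⟩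
      (b + (((i * a) % M) * c) % M) % M     ≡⟨ cong (λ w → (b + (w * c) % M) % M) i*a≡1 ⟩
      (b + (1 * c) % M) % M                 ≡⟨ cong (λ w → (b + w % M) % M) (*-identityˡ c) ⟩
      (b + c % M) % M                       ≡⟨ %-distribʳ-+ b c M ⟩
      (b + c) % M                           ≡⟨ cong (_% M) (m+[n∸m]≡n (≤-trans (<⇒≤ b<M) (n≤1+n M))) ⟩
      suc M % M                             ≡⟨ [m+n]%n≡m%n 1 M ⟩
      1 % M                                 ≡⟨ 1%M≡1 ⟩
      1                                     ∎)
      where
      open ≡-Reasoning
      i : ℕ
      i = proj₁ (inverse a ¬p∣a)

      i*a≡1 : (i * a) % M ≡ 1
      i*a≡1 = proj₂ (inverse a ¬p∣a)

      c : ℕ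
      c = suc M ∸ b

      %-distribˡ-*′ : ∀ x y → ((x % M) * y) % M ≡ (x * y) % M
      %-distribˡ-*′ x y = trans (cong (_% M) (*-comm (x % M) y)) (trans (%-distribʳ-* y x M) (cong (_% M) (*-comm y x)))

    left^ right^ : ℕ → ℕ × ℕ → ℕ × ℕ
    left^ zero    y = y
    left^ (suc k) y = left^ k (left y)
    right^ zero    y = y
    right^ (suc k) y = right^ k (right y)

    reaches-left^ : ∀ {e} k y j → Reaches e (left^ k y) j → Reaches e y (k + j)
    reaches-left^ zero    y j r = r
    reaches-left^ (suc k) y j r = inj₁ (reaches-left^ k (left y) j r)

    reaches-right^ : ∀ {e} k y j → Reaches e (right^ k y) j → Reaches e y (k + j)
    reaches-right^ zero    y j r = r
    reaches-right^ (suc k) y j r = inj₂ (reaches-right^ k (right y) j r)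

    left^-≡ : ∀ k a b → b < M → left^ k (a , b) ≡ (a , (b + k * a) % M)
    left^-≡ zero    a b b< = cong (a ,_) (sym (trans (cong (_% M) (+-identityʳ b)) (m<n⇒m%n≡m b<)))
    left^-≡ (suc k) a b b< = trans (left^-≡ k a ((a + b) % M) (m%n<n (a + b) M)) (cong (a ,_) (begin
      ((a + b) % M + k * a) % M   ≡⟨ cong (_% M) (+-comm ((a + b) % M) (k * a)) ⟩
      (k * a + (a + b) % M) % M   ≡⟨ %-distribʳ-+ (k * a) (a + b) M ⟩
      (k * a + (a + b)) % M       ≡⟨ cong (_% M) (solve 3 (λ k a b → k :* a :+ (a :+ b) := b :+ (a :+ k :* a)) refl k a b) ⟩
      (b + suc k * a) % M         ∎))
      where open ≡-Reasoning

    right^-≡ : ∀ k a b → a < M → right^ k (a , b) ≡ ((a + k * b) % M , b)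
    right^-≡ zero    a b a< = cong (_, b) (sym (trans (cong (_% M) (+-identityʳ a)) (m<n⇒m%n≡m a<)))
    right^-≡ (suc k) a b a< = trans (right^-≡ k ((a + b) % M) b (m%n<n (a + b) M)) (cong (_, b) (begin
      ((a + b) % M + k * b) % M   ≡⟨ cong (_% M) (+-comm ((a + b) % M) (k * b)) ⟩
      (k * b + (a + b) % M) % M   ≡⟨ %-distribʳ-+ (k * b) (a + b) M ⟩
      (k * b + (a + b)) % M       ≡⟨ cong (_% M) (solve 3 (λ k a b → k :* b :+ (a :+ b) := a :+ (b :+ k :* b)) refl k a b) ⟩
      (a + suc k * b) % M         ∎))
      where open ≡-Reasoning

    reaches-origin : ∀ j → Reaches (0 , 1) (0 , 1) j
    reaches-origin zero    = refl
    reaches-origin (suc j) = inj₁ (subst (λ y → Reaches (0 , 1) y j) (sym (cong (0 ,_) 1%M≡1)) (reaches-origin j))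

    -- (a , b) ↦ (a , 1) by left steps, then (a , 1) ↦ (0 , 1) by right steps, then stay put.
    unit-reaches : ∀ a b → a < M → b < M → ¬ p ∣ a → Reaches (0 , 1) (a , b) (M + M)
    unit-reaches a b a< b< ¬p∣a = subst (Reaches (0 , 1) (a , b)) length-≡
        (reaches-left^ k₁ (a , b) (k₂ + pad) (subst (λ y → Reaches (0 , 1) y (k₂ + pad)) (sym to-a1)
          (reaches-right^ k₂ (a , 1) pad (subst (λ y → Reaches (0 , 1) y pad) (sym to-01) (reaches-origin pad)))))
      where
      k₁ : ℕ
      k₁ = proj₁ (solve-b+ka≡1 a b ¬p∣a b<)

      k₁<M : k₁ < M
      k₁<M = proj₁ (proj₂ (solve-b+ka≡1 a b ¬p∣a b<))

      k₂ pad : ℕ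
      k₂ = M ∸ a
      pad = (M + M) ∸ (k₁ + k₂)

      to-a1 : left^ k₁ (a , b) ≡ (a , 1)
      to-a1 = trans (left^-≡ k₁ a b b<) (cong (a ,_) (proj₂ (proj₂ (solve-b+ka≡1 a b ¬p∣a b<))))

      to-01 : right^ k₂ (a , 1) ≡ (0 , 1)
      to-01 = trans (right^-≡ k₂ a 1 a<)
                (cong (_, 1) (trans (cong (_% M) (trans (cong (a +_) (*-identityʳ k₂)) (m+[n∸m]≡n (<⇒≤ a<)))) (n%n≡0 M)))

      length-≡ : k₁ + (k₂ + pad) ≡ M + M
      length-≡ = trans (sym (+-assoc k₁ k₂ pad)) (m+[n∸m]≡n (+-mono-≤ (<⇒≤ k₁<M) (m∸n≤m M a)))

    mixing-time : ℕ
    mixing-time = suc (M + M)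

    primitive?-≡true : ∀ a b → primitive? (a , b) ≡ true → p ∣ a → ¬ p ∣ b
    primitive?-≡true a b prim p∣a p∣b rewrite dec-true (p ∣? a) p∣a | dec-true (p ∣? b) p∣b = case prim of λ ()

    primitive-reaches : ∀ y → Primitive y → Reaches (0 , 1) y mixing-time
    primitive-reaches (a , b) (a< , b< , prim) = via (p ∣? a)
      where
      via : Dec (p ∣ a) → Reaches (0 , 1) (a , b) mixing-time
      via (no ¬p∣a) = inj₁ (unit-reaches a ((a + b) % M) a< (m%n<n (a + b) M) ¬p∣a)
      via (yes p∣a) = inj₂ (unit-reaches ((a + b) % M) b (m%n<n (a + b) M) b< ¬p∣a+b)
        where
        ¬p∣a+b : ¬ p ∣ (a + b) % M
        ¬p∣a+b h = primitive?-≡true a b prim p∣a (∣m+n∣m⇒∣n (Equivalence.to (p∣x%M⇔p∣x (a + b)) h) p∣a)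

    -- Residues below M split into p^K blocks of p consecutive ones, one of them divisible by p.
    #multiples : ∑[ a < M ] 𝟙 (does (p ∣? a)) ≡ p ^ K
    #multiples = trans (cong (λ k → ∑[ a < k ] 𝟙 (does (p ∣? a))) (*-comm p (p ^ K))) (∑-𝟙-∣ (p ^ K) p)

    #units+p^K≡M : ∑[ a < M ] 𝟙 (not (does (p ∣? a))) + p ^ K ≡ M
    #units+p^K≡M = subst₂ (λ k l → ∑[ a < k ] 𝟙 (not (does (p ∣? a))) + p ^ K ≡ l) (*-comm (p ^ K) p) (*-comm (p ^ K) p)
                     (∑-𝟙-∤+q≡q*p (p ^ K) p)

    #primitive+p^K*p^K≡M*M : #primitive + p ^ K * p ^ K ≡ M * M
    #primitive+p^K*p^K≡M*M = begin
      #primitive + p ^ K * p ^ K                                   ≡⟨ cong (#primitive +_) (sym #both-multiples) ⟩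
      #primitive + ∑² (λ (a , b) → 𝟙 (does (p ∣? a) ∧ does (p ∣? b)))
        ≡⟨ sym (∑-distrib-+ M _ _) ⟩
      ∑[ a < M ] (∑[ b < M ] 𝟙 (primitive? (a , b)) + ∑[ b < M ] 𝟙 (does (p ∣? a) ∧ does (p ∣? b)))
        ≡⟨ ∑-cong M (λ a _ → ∑-𝟙-not M (λ b → does (p ∣? a) ∧ does (p ∣? b))) ⟩
      ∑[ _ < M ] M                                                 ≡⟨ ∑-const M M ⟩
      M * M                                                        ∎
      where
      open ≡-Reasoning

      #both-multiples : ∑² (λ (a , b) → 𝟙 (does (p ∣? a) ∧ does (p ∣? b))) ≡ p ^ K * p ^ K
      #both-multiples = begin
        ∑[ a < M ] ∑[ b < M ] 𝟙 (does (p ∣? a) ∧ does (p ∣? b))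
          ≡⟨ ∑-cong M (λ a _ → trans (∑-cong M (λ b _ → 𝟙-∧ (does (p ∣? a)) (does (p ∣? b))))
                                      (∑-distribˡ-* M (𝟙 (does (p ∣? a))) (λ b → 𝟙 (does (p ∣? b))))) ⟩
        ∑[ a < M ] (𝟙 (does (p ∣? a)) * ∑[ b < M ] 𝟙 (does (p ∣? b)))
          ≡⟨ trans (∑-distribʳ-* M _ (λ a → 𝟙 (does (p ∣? a)))) (cong₂ _*_ #multiples #multiples) ⟩
        p ^ K * p ^ K ∎

    private
      p-1 : ℕ
      p-1 = pred p

      p≡1+[p-1] : p ≡ suc p-1
      p≡1+[p-1] = sym (suc-pred p)

      M≡ : M ≡ p ^ K * suc p-1
      M≡ = trans (*-comm p (p ^ K)) (cong (p ^ K *_) p≡1+[p-1])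

    #primitive≡ : #primitive ≡ p ^ K * p ^ K * (p-1 * p-1 + 2 * p-1)
    #primitive≡ = +-cancelʳ-≡ (p ^ K * p ^ K) #primitive _ (trans #primitive+p^K*p^K≡M*M (trans (cong₂ _*_ M≡ M≡)
      (solve 2 (λ m q → (m :* (con 1 :+ q)) :* (m :* (con 1 :+ q)) := m :* m :* (q :* q :+ con 2 :* q) :+ m :* m) refl (p ^ K) p-1)))

    instance
      p^K≢0 : NonZero (p ^ K)
      p^K≢0 = m^n≢0 p K

      #primitive≢0 : NonZero #primitive
      #primitive≢0 = >-nonZero (subst (0 <_) (sym #primitive≡) (*-mono-< (*-mono-< (m^n>0 p K) (m^n>0 p K)) p-1-term>0))
        where
        1≤p-1 : 1 ≤ p-1
        1≤p-1 = s≤s⁻¹ (subst (2 ≤_) p≡1+[p-1] (prime>1 prime))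
        p-1-term>0 : 0 < p-1 * p-1 + 2 * p-1
        p-1-term>0 = ≤-trans 1≤p-1 (≤-trans (m≤m+n p-1 (p-1 + 0)) (m≤n+m (p-1 + (p-1 + 0)) (p-1 * p-1)))

    cwVal[1+k] : ∀ k → cwVal p (ℤ.+ suc k) ≡ (ℤ.+ 1 ℚ./ (p ^ k * suc p)) {{m*n≢0 (p ^ k) (suc p) {{m^n≢0 p k}}}}
    cwVal[1+k] zero    = /*/ 1 1 1 (suc p)
    cwVal[1+k] (suc k) = /*/ 1 (p ^ suc k) 1 (suc p) {{m^n≢0 p (suc k)}}

    -- total = M - p^K; the density is p^K (p - 1) / (p^2K (p^2 - 1)).
    density≡cwVal : ∀ total → total + p ^ K ≡ M → (ℤ.+ total ℚ./ #primitive) ≡ cwVal p (ℤ.+ suc K)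
    density≡cwVal total total+p^K≡M =
      trans (/≡/ total #primitive 1 (p ^ K * suc p) {{#primitive≢0}} {{m*n≢0 (p ^ K) (suc p)}} cross) (sym (cwVal[1+k] K))
      where
      total≡ : total ≡ p ^ K * p-1
      total≡ = +-cancelʳ-≡ (p ^ K) total (p ^ K * p-1)
        (trans total+p^K≡M (trans M≡ (solve 2 (λ m q → m :* (con 1 :+ q) := m :* q :+ m) refl (p ^ K) p-1)))

      cross : total * (p ^ K * suc p) ≡ 1 * #primitive
      cross = begin
        total * (p ^ K * suc p)                   ≡⟨ cong₂ (λ x y → x * (p ^ K * suc y)) total≡ p≡1+[p-1] ⟩
        p ^ K * p-1 * (p ^ K * suc (suc p-1))
          ≡⟨ solve 2 (λ m q → m :* q :* (m :* (con 1 :+ (con 1 :+ q))) := con 1 :* (m :* m :* (q :* q :+ con 2 :* q))) refl (p ^ K) p-1 ⟩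
        1 * (p ^ K * p ^ K * (p-1 * p-1 + 2 * p-1)) ≡⟨ cong (1 *_) (sym #primitive≡) ⟩
        1 * #primitive                            ∎
        where open ≡-Reasoning

    density≡1-cwVal : ∀ total → total + M ≡ #primitive + p ^ K →
      (ℤ.+ total ℚ./ #primitive) ≡ 1ℚ ℚ.- cwVal p (ℤ.+ K ℤ.+ ℤ.+ 1)
    density≡1-cwVal total total+M≡ =
      trans (+≡1⇒≡1- (ℤ.+ total ℚ./ #primitive) (cwVal p (ℤ.+ suc K)) sum≡1)
            (cong (λ k → 1ℚ ℚ.- cwVal p (ℤ.+ k)) (+-comm 1 K))
      where
      #primitive≡total+ : #primitive ≡ total + p ^ K * p-1
      #primitive≡total+ = sym (+-cancelʳ-≡ (p ^ K) (total + p ^ K * p-1) #primitive (trans (trans (+-assoc total (p ^ K * p-1) (p ^ K))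
        (cong (total +_) (trans (solve 2 (λ m q → m :* q :+ m := m :* (con 1 :+ q)) refl (p ^ K) p-1) (sym M≡)))) total+M≡))

      D : ℕ
      D = p ^ K * suc p

      cross : total * D + 1 * #primitive ≡ #primitive * D
      cross = begin
        total * D + 1 * #primitive                                      ≡⟨ cong (total * D +_) (trans (*-identityˡ #primitive) #primitive≡) ⟩
        total * D + p ^ K * p ^ K * (p-1 * p-1 + 2 * p-1)
          ≡⟨ cong (λ y → total * (p ^ K * suc y) + p ^ K * p ^ K * (p-1 * p-1 + 2 * p-1)) p≡1+[p-1] ⟩
        total * (p ^ K * suc (suc p-1)) + p ^ K * p ^ K * (p-1 * p-1 + 2 * p-1)
          ≡⟨ solve 3 (λ s m q → s :* (m :* (con 1 :+ (con 1 :+ q))) :+ m :* m :* (q :* q :+ con 2 :* q) := (s :+ m :* q) :* (m :* (con 1 :+ (con 1 :+ q)))) refl total (p ^ K) p-1 ⟩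
        (total + p ^ K * p-1) * (p ^ K * suc (suc p-1))                 ≡⟨ cong₂ (λ a y → a * (p ^ K * suc y)) (sym #primitive≡total+) (sym p≡1+[p-1]) ⟩
        #primitive * D                                                  ∎
        where open ≡-Reasoning

      sum≡1 : (ℤ.+ total ℚ./ #primitive) ℚ.+ cwVal p (ℤ.+ suc K) ≡ 1ℚ
      sum≡1 = trans (cong ((ℤ.+ total ℚ./ #primitive) ℚ.+_) (cwVal[1+k] K))
                    (/+/≡1 total #primitive 1 D {{#primitive≢0}} {{m*n≢0 (p ^ K) (suc p)}} cross)

    primitive-root : Primitive (1 , 1)
    primitive-root = 1<M , 1<M , cong (λ x → not (x ∧ x)) (dec-false (p ∣? 1) (λ p∣1 → <⇒≢ (prime>1 prime) (sym (∣1⇒≡1 p∣1))))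

    Fseq-converges : ∀ z ν (Q : ℕ × ℕ → Bool) →
      (∀ a b → CWLabel (a , b) → OrdDiffGe p z ν (a , b) ⇔ (Q (a % M , b % M) ≡ true)) →
      ConvergesTo (Fseq p z ν) (ℤ.+ Hitting.total Q 0 ℚ./ #primitive)
    Fseq-converges z ν Q criterion =
      converges-from-window mixing-time (2^-1 mixing-time) (suc[2^-1] mixing-time) (count p z ν) (total 0) #primitive window
      where
      open Hitting Q

      count≡hits : ∀ n → count p z ν n ≡ hits n (1 , 1)
      count≡hits n = begin
        length (filter (ordDiffGe? p z ν) (cwGen n))           ≡⟨ cong (λ l → length (filter (ordDiffGe? p z ν) l)) (cwGen≡cwFrom n) ⟩
        length (filter (ordDiffGe? p z ν) (cwFrom (1 , 1) n))  ≡⟨ #filter≡hits (ordDiffGe? p z ν) criterion n (1 , 1) cwLabel-root ⟩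
        hits n (1 % M , 1 % M)                                 ≡⟨ cong (λ x → hits n (x , x)) 1%M≡1 ⟩
        hits n (1 , 1)                                         ∎
        where open ≡-Reasoning
      open Mixing (0 , 1) mixing-time primitive-reaches

      window : ∀ t r → let n = t * mixing-time + r ; W = #primitive * (2^-1 mixing-time ^ t * 2 ^ r) in
        count p z ν n * #primitive ≤ 2 ^ n * total 0 + W × 2 ^ n * total 0 ≤ count p z ν n * #primitive + W
      window t r rewrite count≡hits (t * mixing-time + r) = hits≈average (1 , 1) primitive-root t r

  module Valuation (p : ℕ) (prime : Prime p) where

    instance
      p≢0′ : NonZero p
      p≢0′ = prime⇒nonZero prime

    ¬∣-* : ∀ {c d} → ¬ p ∣ c → ¬ p ∣ d → ¬ p ∣ c * d
    ¬∣-* {c} {d} ¬p∣c ¬p∣d p∣cd with euclidsLemma c d prime p∣cd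
    ... | inj₁ p∣c = ¬p∣c p∣c
    ... | inj₂ p∣d = ¬p∣d p∣d

    p∣p^[1+i] : ∀ i → p ∣ p ^ suc i
    p∣p^[1+i] i = divides (p ^ i) (*-comm p (p ^ i))

    1<p^[1+i] : ∀ i → 1 < p ^ suc i
    1<p^[1+i] i = ≤-trans (prime>1 prime) (subst (_≤ p ^ suc i) (*-identityʳ p) (*-monoʳ-≤ p (m^n>0 p i)))

    p^i∣p^j*c : ∀ {i j} c → i ≤ j → p ^ i ∣ p ^ j * c
    p^i∣p^j*c {i} {j} c i≤j = divides (p ^ (j ∸ i) * c) (begin
      p ^ j * c                 ≡⟨ cong (λ k → p ^ k * c) (sym (m∸n+n≡m i≤j)) ⟩
      p ^ (j ∸ i + i) * c       ≡⟨ cong (_* c) (^-distribˡ-+-* p (j ∸ i) i) ⟩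
      p ^ (j ∸ i) * p ^ i * c   ≡⟨ solve 3 (λ x y c → x :* y :* c := x :* c :* y) refl (p ^ (j ∸ i)) (p ^ i) c ⟩
      p ^ (j ∸ i) * c * p ^ i   ∎)
      where open ≡-Reasoning

    p^i∣p^j*c⇒i≤j : ∀ {c} → ¬ p ∣ c → ∀ i j → p ^ i ∣ p ^ j * c → i ≤ j
    p^i∣p^j*c⇒i≤j ¬p∣c zero    j       _ = z≤n
    p^i∣p^j*c⇒i≤j ¬p∣c (suc i) zero    h = contradiction (∣-trans (p∣p^[1+i] i) (subst (p ^ suc i ∣_) (+-identityʳ _) h)) ¬p∣c
    p^i∣p^j*c⇒i≤j {c} ¬p∣c (suc i) (suc j) h =
      s≤s (p^i∣p^j*c⇒i≤j ¬p∣c i j (*-cancelˡ-∣ p (subst (p * p ^ i ∣_) (*-assoc p (p ^ j) c) h)))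

    p^i∣p^j*c⇔i≤j : ∀ {c} → ¬ p ∣ c → ∀ i j → p ^ i ∣ p ^ j * c ⇔ i ≤ j
    p^i∣p^j*c⇔i≤j ¬p∣c i j = mk⇔ (p^i∣p^j*c⇒i≤j ¬p∣c i j) (p^i∣p^j*c _)

    p^i*c≡p^j*d⇒i≡j : ∀ {c d} i j → ¬ p ∣ c → ¬ p ∣ d → p ^ i * c ≡ p ^ j * d → i ≡ j
    p^i*c≡p^j*d⇒i≡j {c} {d} i j ¬p∣c ¬p∣d eq =
      ≤-antisym (p^i∣p^j*c⇒i≤j ¬p∣d i j (subst (p ^ i ∣_) eq (p^i∣p^j*c {i} c ≤-refl)))
                (p^i∣p^j*c⇒i≤j ¬p∣c j i (subst (p ^ j ∣_) (sym eq) (p^i∣p^j*c {j} d ≤-refl)))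

    record Split (n : ℕ) : Set where
      constructor split
      field
        exponent  : ℕ
        cofactor  : ℕ
        n≡p^e*c   : n ≡ p ^ exponent * cofactor
        ¬p∣cofactor : ¬ p ∣ cofactor

    exponent≡0⇔¬p∣ : ∀ {n} (s : Split n) → Split.exponent s ≡ 0 ⇔ (¬ p ∣ n)
    exponent≡0⇔¬p∣ (split zero    c n≡ ¬p∣c) = mk⇔ (λ _ p∣n → ¬p∣c (subst (p ∣_) (trans n≡ (*-identityˡ c)) p∣n)) (λ _ → refl)
    exponent≡0⇔¬p∣ (split (suc e) c n≡ ¬p∣c) = mk⇔ (λ ())
      (λ ¬p∣n → contradiction (subst (p ∣_) (sym n≡) (∣-trans (p∣p^[1+i] e) (∣m⇒∣m*n c ∣-refl))) ¬p∣n)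

    split-p : ∀ n → 0 < n → Split n
    split-p n = go n n ≤-refl
      where
      go : ∀ k n → n ≤ k → 0 < n → Split n
      go k n n≤k n>0 with p ∣? n
      go k       n n≤k n>0 | no ¬p∣n = split 0 n (sym (+-identityʳ n)) ¬p∣n
      go zero    n n≤k n>0 | yes _   = contradiction (≤-trans n>0 n≤k) λ ()
      go (suc k) n n≤k n>0 | yes (divides q n≡q*p) =
        let q>0 = n≢0⇒n>0 (λ q≡0 → <-irrefl refl (subst (0 <_) (trans n≡q*p (cong (_* p) q≡0)) n>0))
            q<n = subst (q <_) (sym n≡q*p) (subst (_< q * p) (*-identityʳ q) (*-monoʳ-< q {{>-nonZero q>0}} (prime>1 prime)))
            split β c q≡ ¬p∣c = go k q (≤-pred (≤-trans q<n n≤k)) q>0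
        in split (suc β) c (trans n≡q*p (trans (*-comm q p) (trans (cong (p *_) q≡) (sym (*-assoc p (p ^ β) c))))) ¬p∣c

    split-≤ : ∀ {α δ e f} → α ≡ 0 ⊎ δ ≡ 0 → e ≡ 0 ⊎ f ≡ 0 → δ + e ≤ α + f → e ≤ α × δ ≤ f
    split-≤ {δ = δ}     (inj₁ refl) (inj₁ refl) le = z≤n , subst (_≤ _) (+-identityʳ δ) le
    split-≤ {δ = δ} {e} (inj₁ refl) (inj₂ refl) le = ≤-trans (m≤n+m e δ) le , ≤-trans (m≤m+n δ e) le
    split-≤             (inj₂ refl) (inj₁ refl) le = z≤n , z≤n
    split-≤ {α = α}     (inj₂ refl) (inj₂ refl) le = subst (_ ≤_) (+-identityʳ α) le , z≤n

    ordGe-lowestTerms : ∀ {nu de G X b β b'} → nu * G ≡ X → de * G ≡ b → Coprime nu de →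
      b ≡ p ^ β * b' → ¬ p ∣ b' → 0 < b → ∀ e f → e ≡ 0 ⊎ f ≡ 0 →
      (p ^ e ∣ nu × ¬ p ^ suc f ∣ de) ⇔ p ^ (β + e) ∣ X * p ^ f
    ordGe-lowestTerms {nu} {de} {G} {X} {b} {β} {b'} nuG≡X deG≡b nu⊥de b≡ ¬p∣b' b>0 e f e⊎f = by-numerator nu refl
      where
      G>0 : 0 < G
      G>0 = n≢0⇒n>0 (λ G≡0 → <-irrefl refl (subst (0 <_) (trans (sym deG≡b) (trans (cong (de *_) G≡0) (*-zeroʳ de))) b>0))

      de>0 : 0 < de
      de>0 = n≢0⇒n>0 (λ de≡0 → <-irrefl refl (subst (0 <_) (trans (sym deG≡b) (cong (_* G) de≡0)) b>0))
      open Split (split-p de de>0) renaming (exponent to δ; cofactor to w; n≡p^e*c to de≡; ¬p∣cofactor to ¬p∣w)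
      open Split (split-p G G>0) renaming (exponent to γ; cofactor to h; n≡p^e*c to G≡; ¬p∣cofactor to ¬p∣h)

      δ+γ≡β : δ + γ ≡ β
      δ+γ≡β = p^i*c≡p^j*d⇒i≡j (δ + γ) β (¬∣-* ¬p∣w ¬p∣h) ¬p∣b' (begin
        p ^ (δ + γ) * (w * h)        ≡⟨ cong (_* (w * h)) (^-distribˡ-+-* p δ γ) ⟩
        p ^ δ * p ^ γ * (w * h)      ≡⟨ solve 4 (λ x w y h → x :* y :* (w :* h) := x :* w :* (y :* h)) refl (p ^ δ) w (p ^ γ) h ⟩
        p ^ δ * w * (p ^ γ * h)      ≡⟨ sym (cong₂ _*_ de≡ G≡) ⟩
        de * G                       ≡⟨ trans deG≡b b≡ ⟩
        p ^ β * b'                   ∎)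
        where open ≡-Reasoning

      by-numerator : ∀ n → n ≡ nu → (p ^ e ∣ nu × ¬ p ^ suc f ∣ de) ⇔ p ^ (β + e) ∣ X * p ^ f
      by-numerator zero refl = mk⇔
        (λ _ → subst (λ x → p ^ (β + e) ∣ x * p ^ f) nuG≡X ((p ^ (β + e)) ∣0))
        (λ _ → ((p ^ e) ∣0) , λ p^[1+f]∣de → <-irrefl refl (≤-trans (1<p^[1+i] f)
                 (≤-reflexive (∣1⇒≡1 (subst (p ^ suc f ∣_) (nu⊥de (de ∣0 , ∣-refl)) p^[1+f]∣de)))))
      by-numerator (suc _) n≡nu = mk⇔ to from
        where
        open Split (split-p nu (subst (0 <_) n≡nu z<s)) renaming (exponent to α; cofactor to u; n≡p^e*c to nu≡; ¬p∣cofactor to ¬p∣u)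
        X*p^f≡ : X * p ^ f ≡ p ^ (γ + (α + f)) * (u * h)
        X*p^f≡ = begin
          X * p ^ f                           ≡⟨ cong (_* p ^ f) (sym nuG≡X) ⟩
          nu * G * p ^ f                      ≡⟨ cong₂ (λ x y → x * y * p ^ f) nu≡ G≡ ⟩
          p ^ α * u * (p ^ γ * h) * p ^ f     ≡⟨ solve 5 (λ x u y h z → x :* u :* (y :* h) :* z := y :* (x :* z) :* (u :* h)) refl (p ^ α) u (p ^ γ) h (p ^ f) ⟩
          p ^ γ * (p ^ α * p ^ f) * (u * h)   ≡⟨ cong (λ x → p ^ γ * x * (u * h)) (sym (^-distribˡ-+-* p α f)) ⟩
          p ^ γ * p ^ (α + f) * (u * h)       ≡⟨ cong (_* (u * h)) (sym (^-distribˡ-+-* p γ (α + f))) ⟩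
          p ^ (γ + (α + f)) * (u * h)         ∎
          where open ≡-Reasoning
        β+e≡ : β + e ≡ γ + (δ + e)
        β+e≡ = trans (cong (_+ e) (sym δ+γ≡β)) (solve 3 (λ d g e → d :+ g :+ e := g :+ (d :+ e)) refl δ γ e)
        α⊎δ : α ≡ 0 ⊎ δ ≡ 0
        α⊎δ with α | δ | nu≡ | de≡
        ... | zero  | _     | _ | _ = inj₁ refl
        ... | suc _ | zero  | _ | _ = inj₂ refl
        ... | suc α′ | suc δ′ | nu≡′ | de≡′ = contradiction (nu⊥de
              ( subst (p ∣_) (sym nu≡′) (∣-trans (p∣p^[1+i] α′) (∣m⇒∣m*n u ∣-refl))
              , subst (p ∣_) (sym de≡′) (∣-trans (p∣p^[1+i] δ′) (∣m⇒∣m*n w ∣-refl)))) (<⇒≢ (prime>1 prime) ∘ sym)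
        to : p ^ e ∣ nu × ¬ p ^ suc f ∣ de → p ^ (β + e) ∣ X * p ^ f
        to (p^e∣nu , ¬p^[1+f]∣de) = subst₂ (λ i x → p ^ i ∣ x) (sym β+e≡) (sym X*p^f≡)
            (p^i∣p^j*c (u * h) (+-monoʳ-≤ γ (subst (_≤ α + f) (+-comm e δ) (+-mono-≤ e≤α δ≤f))))
          where
          e≤α : e ≤ α
          e≤α = p^i∣p^j*c⇒i≤j ¬p∣u e α (subst (p ^ e ∣_) nu≡ p^e∣nu)
          δ≤f : δ ≤ f
          δ≤f = ≮⇒≥ (λ f<δ → ¬p^[1+f]∣de (subst (p ^ suc f ∣_) (sym de≡) (p^i∣p^j*c w f<δ)))
        from : p ^ (β + e) ∣ X * p ^ f → p ^ e ∣ nu × ¬ p ^ suc f ∣ de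
        from p^[β+e]∣ = subst (p ^ e ∣_) (sym nu≡) (p^i∣p^j*c u (proj₁ bounds))
                      , λ p^[1+f]∣de → <-irrefl refl (≤-trans (p^i∣p^j*c⇒i≤j ¬p∣w (suc f) δ (subst (p ^ suc f ∣_) de≡ p^[1+f]∣de)) (proj₂ bounds))
          where
          bounds : e ≤ α × δ ≤ f
          bounds = split-≤ α⊎δ e⊎f (+-cancelˡ-≤ γ _ _ (p^i∣p^j*c⇒i≤j (¬∣-* ¬p∣u ¬p∣h) (γ + (δ + e)) (γ + (α + f))
                     (subst₂ (λ i x → p ^ i ∣ x) β+e≡ X*p^f≡ p^[β+e]∣)))

    posPart⊎negPart≡0 : ∀ m → posPart m ≡ 0 ⊎ negPart m ≡ 0
    posPart⊎negPart≡0 (ℤ.+ _)    = inj₂ refl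
    posPart⊎negPart≡0 -[1+ _ ] = inj₁ refl

    ordGeℚ-/⇔ : ∀ (x : ℤ) b₀ β b' → suc b₀ ≡ p ^ β * b' → ¬ p ∣ b' → ∀ m →
      OrdGeℚ p (x ℚ./ suc b₀) m ⇔ p ^ (β + posPart m) ∣ ℤ.∣ x ∣ * p ^ negPart m
    ordGeℚ-/⇔ x b₀ β b' b≡ ¬p∣b' m = lowest (x ℚ./ suc b₀) (ℚP.↥-/ x (suc b₀)) (ℚP.↧-/ x (suc b₀))
      where
      G : ℕ
      G = gcd ℤ.∣ x ∣ (suc b₀)

      lowest : ∀ q → ↥ q ℤ.* ℤ.+ G ≡ x → ↧ q ℤ.* ℤ.+ G ≡ ℤ.+ suc b₀ →
        OrdGeℚ p q m ⇔ p ^ (β + posPart m) ∣ ℤ.∣ x ∣ * p ^ negPart m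
      lowest (mkℚ n d c) nG≡x dG≡b =
        ordGe-lowestTerms {β = β} (trans (sym (ℤP.abs-* n (ℤ.+ G))) (cong ℤ.∣_∣ nG≡x))
          (trans (sym (ℤP.abs-* (ℤ.+ suc d) (ℤ.+ G))) (cong ℤ.∣_∣ dG≡b))
          (recompute c) b≡ ¬p∣b' z<s (posPart m) (negPart m) (posPart⊎negPart≡0 m)

  ∣+m-+n∣≡∣m-n∣ : ∀ m n → ℤ.∣ ℤ.+ m ℤ.- ℤ.+ n ∣ ≡ ∣ m - n ∣
  ∣+m-+n∣≡∣m-n∣ m n rewrite ℤP.[+m]-[+n]≡m⊖n m n with ≤-total m n
  ... | inj₁ m≤n = trans (ℤP.∣⊖∣-≤ m≤n) (sym (m≤n⇒∣m-n∣≡n∸m m≤n))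
  ... | inj₂ n≤m = trans (ℤP.∣m⊖n∣≡∣n⊖m∣ m n) (trans (ℤP.∣⊖∣-≤ n≤m) (sym (trans (∣-∣-comm m n) (m≤n⇒∣m-n∣≡n∸m n≤m))))

  M∣x∸y⇔%≡% : ∀ x y M .{{_ : NonZero M}} → y ≤ x → M ∣ x ∸ y ⇔ x % M ≡ y % M
  M∣x∸y⇔%≡% x y M y≤x = mk⇔
    (λ M∣x∸y → trans (cong (_% M) (sym (m+[n∸m]≡n y≤x))) (%-remove-+ʳ y M∣x∸y))
    (λ x%≡y% → divides (x / M ∸ y / M) (begin
      x ∸ y                                             ≡⟨ cong₂ _∸_ (m≡m%n+[m/n]*n x M) (m≡m%n+[m/n]*n y M) ⟩
      (x % M + x / M * M) ∸ (y % M + y / M * M)         ≡⟨ cong (λ r → (r + x / M * M) ∸ (y % M + y / M * M)) x%≡y% ⟩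
      (y % M + x / M * M) ∸ (y % M + y / M * M)         ≡⟨ [m+n]∸[m+o]≡n∸o (y % M) _ _ ⟩
      x / M * M ∸ y / M * M                             ≡⟨ sym (*-distribʳ-∸ M (x / M) (y / M)) ⟩
      (x / M ∸ y / M) * M                               ∎))
    where open ≡-Reasoning

  M∣∣x-y∣⇔%≡% : ∀ x y M .{{_ : NonZero M}} → M ∣ ∣ x - y ∣ ⇔ x % M ≡ y % M
  M∣∣x-y∣⇔%≡% x y M with ≤-total y x
  ... | inj₁ y≤x rewrite m≤n⇒∣n-m∣≡n∸m y≤x = M∣x∸y⇔%≡% x y M y≤x
  ... | inj₂ x≤y rewrite m≤n⇒∣m-n∣≡n∸m x≤y = mk⇔ (λ h → sym (Equivalence.to (M∣x∸y⇔%≡% y x M x≤y) h))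
                                                (λ h → Equivalence.from (M∣x∸y⇔%≡% y x M x≤y) (sym h))

  ∣∣x-y∣∧∣y⇒∣x : ∀ {q} x y → q ∣ ∣ x - y ∣ → q ∣ y → q ∣ x
  ∣∣x-y∣∧∣y⇒∣x {q} x y q∣∣x-y∣ q∣y with ≤-total y x
  ... | inj₁ y≤x rewrite m≤n⇒∣n-m∣≡n∸m y≤x = subst (q ∣_) (m+[n∸m]≡n y≤x) (∣m∣n⇒∣m+n q∣y q∣∣x-y∣)
  ... | inj₂ x≤y rewrite m≤n⇒∣m-n∣≡n∸m x≤y =
    ∣m+n∣m⇒∣n (subst (q ∣_) (sym (trans (+-comm (y ∸ x) x) (m+[n∸m]≡n x≤y))) q∣y) q∣∣x-y∣

  ∣∣x-y∣∧∣x⇒∣y : ∀ {q} x y → q ∣ ∣ x - y ∣ → q ∣ x → q ∣ y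
  ∣∣x-y∣∧∣x⇒∣y {q} x y h = ∣∣x-y∣∧∣y⇒∣x y x (subst (q ∣_) (∣-∣-comm x y) h)

  trunc-+ : ∀ {p} (d : ℕ → Fin p) i j → trunc d (i + j) ≡ trunc d i + p ^ i * trunc (λ l → d (i + l)) j
  trunc-+ {p} d i zero rewrite +-identityʳ i | *-zeroʳ (p ^ i) = sym (+-identityʳ _)
  trunc-+ {p} d i (suc j) rewrite +-suc i j | trunc-+ d i j =
    trans (cong (λ x → trunc d i + p ^ i * trunc (λ l → d (i + l)) j + toℕ (d (i + j)) * x) (^-distribˡ-+-* p i j))
          (solve 5 (λ A x y D z → A :+ x :* y :+ D :* (x :* z) := A :+ x :* (y :+ D :* z)) refl
            (trunc d i) (p ^ i) (trunc (λ l → d (i + l)) j) (toℕ (d (i + j))) (p ^ j))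

  trunc-mono-≤ : ∀ {p} (d : ℕ → Fin p) {i j} → i ≤ j → trunc d i ≤ trunc d j
  trunc-mono-≤ {p} d {i} {j} i≤j = subst (λ k → trunc d i ≤ trunc d k) (m+[n∸m]≡n i≤j)
    (subst (trunc d i ≤_) (sym (trunc-+ d i (j ∸ i))) (m≤m+n _ _))

  trunc-≡0 : ∀ {p} (d : ℕ → Fin p) → (∀ i → toℕ (d i) ≡ 0) → ∀ j → trunc d j ≡ 0
  trunc-≡0 d d≡0 zero    = refl
  trunc-≡0 d d≡0 (suc j) rewrite trunc-≡0 d d≡0 j | d≡0 j = refl

  -- trunc d j ≡ 0 ≢ trunc d (suc j) says that j is the index of the first nonzero digit.
  first-nonzero-unique : ∀ {p} (d : ℕ → Fin p) i j → trunc d i ≡ 0 → trunc d (suc i) ≢ 0 →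
    trunc d j ≡ 0 → trunc d (suc j) ≢ 0 → i ≡ j
  first-nonzero-unique d i j ti≡0 ti+1≢0 tj≡0 tj+1≢0 with <-cmp i j
  ... | tri≈ _ i≡j _ = i≡j
  ... | tri< i<j _ _ = contradiction (n≤0⇒n≡0 (subst (trunc d (suc i) ≤_) tj≡0 (trunc-mono-≤ d i<j))) ti+1≢0
  ... | tri> _ _ j<i = contradiction (n≤0⇒n≡0 (subst (trunc d (suc j) ≤_) ti≡0 (trunc-mono-≤ d j<i))) tj+1≢0

  first-nonzero⇒¬p∣ : ∀ {p} (d : ℕ → Fin p) j → trunc d j ≡ 0 → trunc d (suc j) ≢ 0 → ∀ t → ¬ p ∣ trunc (λ l → d (j + l)) (suc t)
  first-nonzero⇒¬p∣ {p} d j tj≡0 tj+1≢0 t p∣ = dj≢0 (trans (cong (λ k → toℕ (d k)) (sym (+-identityʳ j))) x≡0)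
    where
    x rest : ℕ
    x = toℕ (d (j + 0))
    rest = trunc (λ l → d (j + suc l)) t

    p∣x : p ∣ x
    p∣x = subst (p ∣_) (trans (+-identityˡ (x * 1)) (*-identityʳ x))
            (∣m+n∣m⇒∣n (subst (p ∣_) (trans (trunc-+ (λ l → d (j + l)) 1 t) (+-comm (0 + x * 1) (p ^ 1 * rest))) p∣)
              (∣m⇒∣m*n rest (subst (p ∣_) (sym (*-identityʳ p)) ∣-refl)))

    x≡0 : x ≡ 0
    x≡0 with x | p∣x | toℕ<n (d (j + 0))
    ... | zero   | _   | _   = refl
    ... | suc x′ | p∣x′ | x<p = contradiction (≤-<-trans (∣⇒≤ p∣x′) x<p) (<-irrefl refl)

    dj≢0 : toℕ (d j) ≢ 0
    dj≢0 dj≡0 = tj+1≢0 (trans (cong (λ x → x + toℕ (d j) * p ^ j) tj≡0) (cong (_* p ^ j) dj≡0))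

  does≡true⇔ : ∀ {A : Set} (a? : Dec A) → does a? ≡ true ⇔ A
  does≡true⇔ (yes a) = mk⇔ (λ _ → a) (λ _ → refl)
  does≡true⇔ (no ¬a) = mk⇔ (λ ()) (λ a → contradiction a ¬a)

  not-does≡true⇔ : ∀ {A : Set} (a? : Dec A) → not (does a?) ≡ true ⇔ (¬ A)
  not-does≡true⇔ (yes a) = mk⇔ (λ ()) (λ ¬a → contradiction a ¬a)
  not-does≡true⇔ (no ¬a) = mk⇔ (λ _ → ¬a) (λ _ → refl)

  ∧≡true⇔ : ∀ x y → (x ∧ y) ≡ true ⇔ (x ≡ true × y ≡ true)
  ∧≡true⇔ true  y = mk⇔ (refl ,_) proj₂
  ∧≡true⇔ false y = mk⇔ (λ ()) (λ ())

  module ⇔-Reasoning = SetoidReasoning (⇔-setoid 0ℓ)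

  module Criterion (p : ℕ) (prime : Prime p) (z : Qp p) (ν : ℤ) where
    open Valuation p prime public

    k : ℕ
    k = shift z

    m : ℤ
    m = ν ℤ.+ ℤ.+ k

    T : ℕ
    T = trunc (digits z) (posPart m)

    ordDiffGe⇔ : ∀ a b₀ (s : Split (suc b₀)) →
      OrdDiffGe p z ν (a , suc b₀) ⇔ p ^ (Split.exponent s + posPart m) ∣ ∣ p ^ k * a - T * suc b₀ ∣ * p ^ negPart m
    ordDiffGe⇔ a b₀ (split β b' b≡ ¬p∣b') =
      subst (λ x → OrdDiffGe p z ν (a , suc b₀) ⇔ p ^ (β + posPart m) ∣ x * p ^ negPart m)
        (∣+m-+n∣≡∣m-n∣ (p ^ k * a) (T * suc b₀))
        (ordGeℚ-/⇔ (ℤ.+ (p ^ k * a) ℤ.- ℤ.+ (T * suc b₀)) b₀ β b' b≡ ¬p∣b' m)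

    p∣label-numerator⇒¬p∣denominator : ∀ {a b} → CWLabel (a , b) → p ∣ a → ¬ p ∣ b
    p∣label-numerator⇒¬p∣denominator (a⊥b , _) p∣a p∣b = <⇒≢ (prime>1 prime) (sym (a⊥b (p∣a , p∣b)))

  module IntegralCase (p : ℕ) (prime : Prime p) (z : Qp p) (K : ℕ) (z∈ℤp : InZp z) where
    open PrimePower p prime K
    open Criterion p prime z (ℤ.+ suc K)

    T′ : ℕ
    T′ = trunc (λ l → digits z (k + l)) (suc K)

    T≡p^k*T′ : T ≡ p ^ k * T′
    T≡p^k*T′ = begin
      trunc (digits z) (suc K + k)            ≡⟨ cong (trunc (digits z)) (+-comm (suc K) k) ⟩
      trunc (digits z) (k + suc K)            ≡⟨ trunc-+ (digits z) k (suc K) ⟩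
      trunc (digits z) k + p ^ k * T′         ≡⟨ cong (_+ p ^ k * T′) z∈ℤp ⟩
      p ^ k * T′                              ∎
      where open ≡-Reasoning

    -- The label a/b is close to z iff p ∤ b and a ≡ T′ b (mod M).
    Q : ℕ × ℕ → Bool
    Q (α , β) = not (does (p ∣? β)) ∧ does (α ≟ (T′ * β) % M)

    Q≡true⇔ : ∀ α β → Q (α , β) ≡ true ⇔ (¬ p ∣ β × α ≡ (T′ * β) % M)
    Q≡true⇔ α β = ⇔-trans (∧≡true⇔ _ _) (not-does≡true⇔ (p ∣? β) ×-⇔ does≡true⇔ (α ≟ (T′ * β) % M))

    module Label (a b₀ : ℕ) (lab : CWLabel (a , suc b₀)) where

      b : ℕ
      b = suc b₀

      s : Split b
      s = split-p b z<s

      β : ℕ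
      β = Split.exponent s

      β≡0⇔ : β ≡ 0 ⇔ (¬ p ∣ b)
      β≡0⇔ = exponent≡0⇔¬p∣ s

      D : ℕ
      D = ∣ a - T′ * b ∣

      numerator≡p^k*D : ∣ p ^ k * a - T * b ∣ * 1 ≡ p ^ k * D
      numerator≡p^k*D = begin
        ∣ p ^ k * a - T * b ∣ * 1            ≡⟨ *-identityʳ _ ⟩
        ∣ p ^ k * a - T * b ∣                ≡⟨ cong (λ t → ∣ p ^ k * a - t * b ∣) T≡p^k*T′ ⟩
        ∣ p ^ k * a - p ^ k * T′ * b ∣       ≡⟨ cong (λ t → ∣ p ^ k * a - t ∣) (*-assoc (p ^ k) T′ b) ⟩
        ∣ p ^ k * a - p ^ k * (T′ * b) ∣     ≡⟨ sym (*-distribˡ-∣-∣ (p ^ k) a (T′ * b)) ⟩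
        p ^ k * D                            ∎
        where open ≡-Reasoning

      p^[β+[1+K+k]]≡ : p ^ (β + (suc K + k)) ≡ p ^ k * p ^ (β + suc K)
      p^[β+[1+K+k]]≡ = trans (cong (p ^_) (solve 3 (λ b n k → b :+ (n :+ k) := k :+ (b :+ n)) refl β (suc K) k))
                            (^-distribˡ-+-* p k (β + suc K))

      cancel-p^k : p ^ (β + (suc K + k)) ∣ ∣ p ^ k * a - T * b ∣ * 1 ⇔ p ^ (β + suc K) ∣ D
      cancel-p^k = mk⇔
        (λ h → *-cancelˡ-∣ (p ^ k) {{m^n≢0 p k}} (subst₂ _∣_ p^[β+[1+K+k]]≡ numerator≡p^k*D h))
        (λ h → subst₂ _∣_ (sym p^[β+[1+K+k]]≡) (sym numerator≡p^k*D) (*-monoʳ-∣ (p ^ k) h))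

      -- p divides D, so it cannot also divide b: it would then divide a.
      β≡0 : p ^ (β + suc K) ∣ D → β ≡ 0
      β≡0 h = Equivalence.from β≡0⇔ λ p∣b → p∣label-numerator⇒¬p∣denominator lab
        (∣∣x-y∣∧∣y⇒∣x a (T′ * b) (∣-trans (subst (λ x → p ∣ p ^ x) (sym (+-suc β K)) (p∣p^[1+i] (β + K))) h) (∣n⇒∣m*n T′ p∣b)) p∣b

      unit-denominator : p ^ (β + suc K) ∣ D ⇔ (¬ p ∣ b × M ∣ D)
      unit-denominator = mk⇔
        (λ h → Equivalence.to β≡0⇔ (β≡0 h) , subst (λ e → p ^ (e + suc K) ∣ D) (β≡0 h) h)
        (λ (¬p∣b , M∣D) → subst (λ e → p ^ (e + suc K) ∣ D) (sym (Equivalence.from β≡0⇔ ¬p∣b)) M∣D)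

      residues : (¬ p ∣ b × M ∣ D) ⇔ (¬ p ∣ b % M × a % M ≡ (T′ * (b % M)) % M)
      residues = mk⇔
        (λ (¬p∣b , M∣D) → ¬p∣b ∘ ∣n∣m%n⇒∣m p∣M
                        , trans (Equivalence.to (M∣∣x-y∣⇔%≡% a (T′ * b) M) M∣D) (sym (%-distribʳ-* T′ b M)))
        (λ (¬p∣b%M , a≡) → ¬p∣b%M ∘ (λ p∣b → %-presˡ-∣ p∣b p∣M)
                         , Equivalence.from (M∣∣x-y∣⇔%≡% a (T′ * b) M) (trans a≡ (%-distribʳ-* T′ b M)))

    criterion : ∀ a b → CWLabel (a , b) → OrdDiffGe p z (ℤ.+ suc K) (a , b) ⇔ (Q (a % M , b % M) ≡ true)
    criterion a (suc b₀) lab = begin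
      OrdDiffGe p z (ℤ.+ suc K) (a , b)                          ≈⟨ ordDiffGe⇔ a b₀ s ⟩
      p ^ (β + (suc K + k)) ∣ ∣ p ^ k * a - T * b ∣ * 1          ≈⟨ cancel-p^k ⟩
      p ^ (β + suc K) ∣ D                                        ≈⟨ unit-denominator ⟩
      (¬ p ∣ b × M ∣ D)                                          ≈⟨ residues ⟩
      (¬ p ∣ b % M × a % M ≡ (T′ * (b % M)) % M)                 ≈⟨ ⇔-sym (Q≡true⇔ (a % M) (b % M)) ⟩
      Q (a % M , b % M) ≡ true                                   ∎
      where
      open Label a b₀ lab
      open ⇔-Reasoning

    total+p^K≡M : Hitting.total Q 0 + p ^ K ≡ M
    total+p^K≡M = trans (cong (_+ p ^ K) total≡) #units+p^K≡M
      where
      open Hitting Q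
      open ≡-Reasoning

      term : ∀ a b → 𝟙 (primitive? (a , b)) * 𝟙 (Q (a , b)) ≡ 𝟙 (not (does (p ∣? b))) * 𝟙 (does (a ≟ (T′ * b) % M))
      term a b with p ∣? b
      ... | yes _ = *-zeroʳ (𝟙 (not (does (p ∣? a) ∧ true)))
      ... | no  _ rewrite ∧-zeroʳ (does (p ∣? a)) = refl

      total≡ : total 0 ≡ ∑[ b < M ] 𝟙 (not (does (p ∣? b)))
      total≡ = begin
        total 0                                                              ≡⟨ ∑²-cong (λ a b _ _ → term a b) ⟩
        ∑[ a < M ] ∑[ b < M ] (𝟙 (not (does (p ∣? b))) * 𝟙 (does (a ≟ (T′ * b) % M)))
          ≡⟨ ∑-swap M M (λ a b → 𝟙 (not (does (p ∣? b))) * 𝟙 (does (a ≟ (T′ * b) % M))) ⟩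
        ∑[ b < M ] ∑[ a < M ] (𝟙 (not (does (p ∣? b))) * 𝟙 (does (a ≟ (T′ * b) % M)))
          ≡⟨ ∑-cong M (λ b _ → trans (∑-distribˡ-* M (𝟙 (not (does (p ∣? b)))) (λ a → 𝟙 (does (a ≟ (T′ * b) % M))))
                (trans (cong (𝟙 (not (does (p ∣? b))) *_) (∑-𝟙-≡ M ((T′ * b) % M) (m%n<n (T′ * b) M))) (*-identityʳ _))) ⟩
        ∑[ b < M ] 𝟙 (not (does (p ∣? b)))                                   ∎

  posPart[-a+b]+a≡b+negPart : ∀ a b → posPart (ℤ.- (ℤ.+ a) ℤ.+ ℤ.+ b) + a ≡ b + negPart (ℤ.- (ℤ.+ a) ℤ.+ ℤ.+ b)
  posPart[-a+b]+a≡b+negPart zero    b = refl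
  posPart[-a+b]+a≡b+negPart (suc a) b with b ≤? a
  ... | yes b≤a rewrite ℤP.⊖-< (s≤s b≤a) | +-∸-assoc 1 b≤a = trans (cong suc (sym (m+[n∸m]≡n b≤a))) (sym (+-suc b (a ∸ b)))
  ... | no  b≰a rewrite ℤP.⊖-≥ (≰⇒> b≰a) = trans (m∸n+n≡m (≰⇒> b≰a)) (sym (+-identityʳ b))

  module ZeroCase (p : ℕ) (prime : Prime p) (z : Qp p) (ν′ : ℕ) (z≡0 : IsZero z) where
    open PrimePower p prime ν′
    open Criterion p prime z (ℤ.- ℤ.+ ν′)

    -- ord (a/b) ≥ -ν′ iff p^(ν′+1) ∤ b.
    Q : ℕ × ℕ → Bool
    Q (α , β) = not (does (β ≟ 0))

    module Label (a b₀ : ℕ) (lab : CWLabel (a , suc b₀)) where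

      b : ℕ
      b = suc b₀

      sb : Split b
      sb = split-p b z<s

      open Split sb renaming (exponent to β; cofactor to b′; n≡p^e*c to b≡; ¬p∣cofactor to ¬p∣b′) public

      a>0 : 0 < a
      a>0 = proj₁ (proj₂ lab)

      sa : Split a
      sa = split-p a a>0

      open Split sa renaming (exponent to α; cofactor to a′; n≡p^e*c to a≡; ¬p∣cofactor to ¬p∣a′) public

      T≡0 : T ≡ 0
      T≡0 = trunc-≡0 (digits z) z≡0 (posPart m)

      numerator≡ : ∣ p ^ k * a - T * b ∣ * p ^ negPart m ≡ p ^ (k + α + negPart m) * a′
      numerator≡ = begin
        ∣ p ^ k * a - T * b ∣ * p ^ negPart m       ≡⟨ cong (λ t → ∣ p ^ k * a - t * b ∣ * p ^ negPart m) T≡0 ⟩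
        ∣ p ^ k * a - 0 ∣ * p ^ negPart m           ≡⟨ cong (_* p ^ negPart m) (∣-∣-identityʳ (p ^ k * a)) ⟩
        p ^ k * a * p ^ negPart m                   ≡⟨ cong (λ x → p ^ k * x * p ^ negPart m) a≡ ⟩
        p ^ k * (p ^ α * a′) * p ^ negPart m        ≡⟨ solve 4 (λ x y u w → x :* (y :* u) :* w := x :* y :* w :* u) refl (p ^ k) (p ^ α) a′ (p ^ negPart m) ⟩
        p ^ k * p ^ α * p ^ negPart m * a′          ≡⟨ cong (λ x → x * p ^ negPart m * a′) (sym (^-distribˡ-+-* p k α)) ⟩
        p ^ (k + α) * p ^ negPart m * a′            ≡⟨ cong (_* a′) (sym (^-distribˡ-+-* p (k + α) (negPart m))) ⟩
        p ^ (k + α + negPart m) * a′                ∎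
        where open ≡-Reasoning

      posPart+ν′≡k+negPart : posPart m + ν′ ≡ k + negPart m
      posPart+ν′≡k+negPart = posPart[-a+b]+a≡b+negPart ν′ k

      α⊎β≡0 : α ≡ 0 ⊎ β ≡ 0
      α⊎β≡0 = by-cases (p ∣? a)
        where
        by-cases : Dec (p ∣ a) → α ≡ 0 ⊎ β ≡ 0
        by-cases (no ¬p∣a) = inj₁ (Equivalence.from (exponent≡0⇔¬p∣ sa) ¬p∣a)
        by-cases (yes p∣a) = inj₂ (Equivalence.from (exponent≡0⇔¬p∣ sb) (p∣label-numerator⇒¬p∣denominator lab p∣a))

      exponent-bound⇔β≤ν′ : (β + posPart m ≤ k + α + negPart m) ⇔ β ≤ ν′
      exponent-bound⇔β≤ν′ = mk⇔ bound⇒ bound⇐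
        where
        bound⇒ : β + posPart m ≤ k + α + negPart m → β ≤ ν′
        bound⇒ h with α⊎β≡0
        ... | inj₂ β≡0 = subst (_≤ ν′) (sym β≡0) z≤n
        ... | inj₁ α≡0 = +-cancelʳ-≤ (posPart m) β ν′ (subst (β + posPart m ≤_)
              (trans (cong (λ x → k + x + negPart m) α≡0) (trans (cong (_+ negPart m) (+-identityʳ k))
                (trans (sym posPart+ν′≡k+negPart) (+-comm (posPart m) ν′)))) h)
        bound⇐ : β ≤ ν′ → β + posPart m ≤ k + α + negPart m
        bound⇐ β≤ν′ = ≤-trans (+-monoˡ-≤ (posPart m) β≤ν′)
          (≤-trans (≤-reflexive (trans (+-comm ν′ (posPart m)) posPart+ν′≡k+negPart)) (+-monoˡ-≤ (negPart m) (m≤m+n k α)))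

      divisible⇔exponent-bound : p ^ (β + posPart m) ∣ ∣ p ^ k * a - T * b ∣ * p ^ negPart m ⇔ (β + posPart m ≤ k + α + negPart m)
      divisible⇔exponent-bound = subst (λ x → (p ^ (β + posPart m) ∣ x) ⇔ (β + posPart m ≤ k + α + negPart m)) (sym numerator≡)
        (p^i∣p^j*c⇔i≤j ¬p∣a′ (β + posPart m) (k + α + negPart m))

      β≤ν′⇔b%M≢0 : β ≤ ν′ ⇔ (b % M ≢ 0)
      β≤ν′⇔b%M≢0 = mk⇔
        (λ β≤ν′ b%M≡0 → <⇒≱ (p^i∣p^j*c⇒i≤j ¬p∣b′ (suc ν′) β (subst (M ∣_) b≡ (m%n≡0⇒n∣m b M b%M≡0))) β≤ν′)
        (λ b%M≢0 → ≮⇒≥ λ ν′<β → b%M≢0 (n∣m⇒m%n≡0 b M (subst (M ∣_) (sym b≡) (p^i∣p^j*c b′ ν′<β))))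

    criterion : ∀ a b → CWLabel (a , b) → OrdDiffGe p z (ℤ.- ℤ.+ ν′) (a , b) ⇔ (Q (a % M , b % M) ≡ true)
    criterion a (suc b₀) lab = begin
      OrdDiffGe p z (ℤ.- ℤ.+ ν′) (a , b)                        ≈⟨ ordDiffGe⇔ a b₀ sb ⟩
      p ^ (β + posPart m) ∣ ∣ p ^ k * a - T * b ∣ * p ^ negPart m ≈⟨ divisible⇔exponent-bound ⟩
      β + posPart m ≤ k + α + negPart m                          ≈⟨ exponent-bound⇔β≤ν′ ⟩
      β ≤ ν′                                                     ≈⟨ β≤ν′⇔b%M≢0 ⟩
      b % M ≢ 0                                                  ≈⟨ ⇔-sym (not-does≡true⇔ (b % M ≟ 0)) ⟩
      Q (a % M , b % M) ≡ true                                   ∎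
      where
      open Label a b₀ lab
      open ⇔-Reasoning

    total+M≡#primitive+p^ν′ : Hitting.total Q 0 + M ≡ #primitive + p ^ ν′
    total+M≡#primitive+p^ν′ = begin
      total 0 + M                                                    ≡⟨ cong (total 0 +_) (sym #units+p^K≡M) ⟩
      total 0 + (∑[ a < M ] 𝟙 (not (does (p ∣? a))) + p ^ ν′)        ≡⟨ sym (+-assoc (total 0) _ (p ^ ν′)) ⟩
      total 0 + ∑[ a < M ] 𝟙 (not (does (p ∣? a))) + p ^ ν′          ≡⟨ cong (λ x → total 0 + x + p ^ ν′) (sym #primitive-on-axis) ⟩
      total 0 + ∑² (λ y → 𝟙 (primitive? y) * 𝟙 (does (proj₂ y ≟ 0))) + p ^ ν′
        ≡⟨ cong (_+ p ^ ν′) (sym (∑²-distrib-+ _ _)) ⟩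
      ∑² (λ y → 𝟙 (primitive? y) * 𝟙 (Q y) + 𝟙 (primitive? y) * 𝟙 (does (proj₂ y ≟ 0))) + p ^ ν′
        ≡⟨ cong (_+ p ^ ν′) (∑²-cong (λ a b _ _ → split-on-b (primitive? (a , b)) (does (b ≟ 0)))) ⟩
      #primitive + p ^ ν′                                            ∎
      where
      open Hitting Q
      open ≡-Reasoning

      split-on-b : ∀ x y → 𝟙 x * 𝟙 (not y) + 𝟙 x * 𝟙 y ≡ 𝟙 x
      split-on-b x y = trans (sym (*-distribˡ-+ (𝟙 x) (𝟙 (not y)) (𝟙 y))) (trans (cong (𝟙 x *_) (𝟙-not y)) (*-identityʳ (𝟙 x)))

      primitive?[a,0] : ∀ a → primitive? (a , 0) ≡ not (does (p ∣? a))
      primitive?[a,0] a rewrite dec-true (p ∣? 0) (p ∣0) = cong not (∧-identityʳ _)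

      #primitive-on-axis : ∑² (λ y → 𝟙 (primitive? y) * 𝟙 (does (proj₂ y ≟ 0))) ≡ ∑[ a < M ] 𝟙 (not (does (p ∣? a)))
      #primitive-on-axis = ∑-cong M (λ a _ → trans (∑-at-0 M (λ b → 𝟙 (primitive? (a , b))) (m^n>0 p (suc ν′))) (cong 𝟙 (primitive?[a,0] a)))

  module FractionalCase (p : ℕ) (prime : Prime p) (z : Qp p) (l t′ j : ℕ) (ν : ℤ)
    (k≡j+λ : shift z ≡ j + suc l) (m≡j+t : ν ℤ.+ ℤ.+ shift z ≡ ℤ.+ (j + suc t′))
    (tj≡0 : trunc (digits z) j ≡ 0) (tj+1≢0 : trunc (digits z) (suc j) ≢ 0) where

    λ′ t : ℕ
    λ′ = suc l
    t = suc t′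

    open PrimePower p prime (l + t)
    open Criterion p prime z ν

    instance
      p^λ≢0 : NonZero (p ^ λ′)
      p^λ≢0 = m^n≢0 p λ′

      p^t≢0 : NonZero (p ^ t)
      p^t≢0 = m^n≢0 p t

      p^t*p^λ≢0 : NonZero (p ^ t * p ^ λ′)
      p^t*p^λ≢0 = m*n≢0 (p ^ t) (p ^ λ′)

    W : ℕ
    W = trunc (λ i → digits z (j + i)) t

    ¬p∣W : ¬ p ∣ W
    ¬p∣W = first-nonzero⇒¬p∣ (digits z) j tj≡0 tj+1≢0 t′

    T≡p^j*W : T ≡ p ^ j * W
    T≡p^j*W = begin
      trunc (digits z) (posPart m)        ≡⟨ cong (λ x → trunc (digits z) (posPart x)) m≡j+t ⟩
      trunc (digits z) (j + t)            ≡⟨ trunc-+ (digits z) j t ⟩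
      trunc (digits z) j + p ^ j * W      ≡⟨ cong (_+ p ^ j * W) tj≡0 ⟩
      p ^ j * W                           ∎
      where open ≡-Reasoning

    M≡p^λ*p^t : M ≡ p ^ λ′ * p ^ t
    M≡p^λ*p^t = ^-distribˡ-+-* p λ′ t

    p^t∣M : p ^ t ∣ M
    p^t∣M = subst (p ^ t ∣_) (sym M≡p^λ*p^t) (divides (p ^ λ′) refl)

    p^λ∣M : p ^ λ′ ∣ M
    p^λ∣M = subst (p ^ λ′ ∣_) (sym M≡p^λ*p^t) (divides (p ^ t) (*-comm (p ^ λ′) (p ^ t)))

    p^[1+λ]∣M : p ^ suc λ′ ∣ M
    p^[1+λ]∣M = subst (p ^ suc λ′ ∣_) (*-identityʳ M) (p^i∣p^j*c {suc λ′} {λ′ + t} 1 (subst (suc λ′ ≤_) (sym (+-suc λ′ t′)) (s≤s (m≤m+n λ′ t′))))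

    -- a/b is close to z iff ord b = λ and a ≡ W (b / p^λ) (mod p^t).
    Q : ℕ × ℕ → Bool
    Q (α , β) = does (p ^ λ′ ∣? β) ∧ (not (does (p ^ suc λ′ ∣? β)) ∧ does (α % p ^ t ≟ (W * (β / p ^ λ′)) % p ^ t))

    Q≡true⇔ : ∀ α β → Q (α , β) ≡ true ⇔ (p ^ λ′ ∣ β × ¬ p ^ suc λ′ ∣ β × α % p ^ t ≡ (W * (β / p ^ λ′)) % p ^ t)
    Q≡true⇔ α β = ⇔-trans (∧≡true⇔ _ _) (does≡true⇔ (p ^ λ′ ∣? β) ×-⇔
                    ⇔-trans (∧≡true⇔ _ _) (not-does≡true⇔ (p ^ suc λ′ ∣? β) ×-⇔ does≡true⇔ (α % p ^ t ≟ (W * (β / p ^ λ′)) % p ^ t)))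

    module Label (a b₀ : ℕ) (lab : CWLabel (a , suc b₀)) where

      b : ℕ
      b = suc b₀

      sb : Split b
      sb = split-p b z<s

      open Split sb renaming (exponent to β; cofactor to b′; n≡p^e*c to b≡; ¬p∣cofactor to ¬p∣b′) public

      D : ℕ
      D = ∣ p ^ λ′ * a - W * b ∣

      numerator≡ : ∣ p ^ k * a - T * b ∣ * p ^ negPart m ≡ p ^ j * D
      numerator≡ = begin
        ∣ p ^ k * a - T * b ∣ * p ^ negPart m               ≡⟨ cong (λ x → ∣ p ^ k * a - T * b ∣ * p ^ negPart x) m≡j+t ⟩
        ∣ p ^ k * a - T * b ∣ * 1                           ≡⟨ *-identityʳ _ ⟩
        ∣ p ^ k * a - T * b ∣                               ≡⟨ cong₂ (λ x y → ∣ p ^ x * a - y * b ∣) k≡j+λ T≡p^j*W ⟩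
        ∣ p ^ (j + λ′) * a - p ^ j * W * b ∣                ≡⟨ cong (λ x → ∣ x * a - p ^ j * W * b ∣) (^-distribˡ-+-* p j λ′) ⟩
        ∣ p ^ j * p ^ λ′ * a - p ^ j * W * b ∣              ≡⟨ cong₂ (λ x y → ∣ x - y ∣) (*-assoc (p ^ j) (p ^ λ′) a) (*-assoc (p ^ j) W b) ⟩
        ∣ p ^ j * (p ^ λ′ * a) - p ^ j * (W * b) ∣          ≡⟨ sym (*-distribˡ-∣-∣ (p ^ j) (p ^ λ′ * a) (W * b)) ⟩
        p ^ j * D                                           ∎
        where open ≡-Reasoning

      p^[β+m]≡ : p ^ (β + posPart m) ≡ p ^ j * p ^ (β + t)
      p^[β+m]≡ = trans (cong (λ x → p ^ (β + posPart x)) m≡j+t)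
        (trans (cong (p ^_) (solve 3 (λ b j t → b :+ (j :+ t) := j :+ (b :+ t)) refl β j t)) (^-distribˡ-+-* p j (β + t)))

      cancel-p^j : p ^ (β + posPart m) ∣ ∣ p ^ k * a - T * b ∣ * p ^ negPart m ⇔ p ^ (β + t) ∣ D
      cancel-p^j = mk⇔
        (λ h → *-cancelˡ-∣ (p ^ j) {{m^n≢0 p j}} (subst₂ _∣_ p^[β+m]≡ numerator≡ h))
        (λ h → subst₂ _∣_ (sym p^[β+m]≡) (sym numerator≡) (*-monoʳ-∣ (p ^ j) h))

      -- With b = p^β b′, D = p^min(β,λ) |p^(λ-β) a - W p^(β-λ) b′|, and the second factor
      -- is prime to p unless β = λ.
      D≡ : ∀ δ → β + δ ≡ λ′ → D ≡ p ^ β * ∣ p ^ δ * a - W * b′ ∣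
      D≡ δ β+δ≡λ = begin
        ∣ p ^ λ′ * a - W * b ∣                            ≡⟨ cong₂ (λ x y → ∣ p ^ x * a - W * y ∣) (sym β+δ≡λ) b≡ ⟩
        ∣ p ^ (β + δ) * a - W * (p ^ β * b′) ∣            ≡⟨ cong (λ x → ∣ x * a - W * (p ^ β * b′) ∣) (^-distribˡ-+-* p β δ) ⟩
        ∣ p ^ β * p ^ δ * a - W * (p ^ β * b′) ∣          ≡⟨ cong₂ (λ x y → ∣ x - y ∣) (*-assoc (p ^ β) (p ^ δ) a)
                                                              (solve 3 (λ w x b → w :* (x :* b) := x :* (w :* b)) refl W (p ^ β) b′) ⟩
        ∣ p ^ β * (p ^ δ * a) - p ^ β * (W * b′) ∣        ≡⟨ sym (*-distribˡ-∣-∣ (p ^ β) (p ^ δ * a) (W * b′)) ⟩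
        p ^ β * ∣ p ^ δ * a - W * b′ ∣                    ∎
        where open ≡-Reasoning

      D≡′ : ∀ δ → λ′ + δ ≡ β → D ≡ p ^ λ′ * ∣ a - W * (p ^ δ * b′) ∣
      D≡′ δ λ+δ≡β = begin
        ∣ p ^ λ′ * a - W * b ∣                            ≡⟨ cong (λ y → ∣ p ^ λ′ * a - W * y ∣) (trans b≡ (cong (λ x → p ^ x * b′) (sym λ+δ≡β))) ⟩
        ∣ p ^ λ′ * a - W * (p ^ (λ′ + δ) * b′) ∣          ≡⟨ cong (λ x → ∣ p ^ λ′ * a - W * (x * b′) ∣) (^-distribˡ-+-* p λ′ δ) ⟩
        ∣ p ^ λ′ * a - W * (p ^ λ′ * p ^ δ * b′) ∣
          ≡⟨ cong (λ x → ∣ p ^ λ′ * a - x ∣) (solve 4 (λ w x y b → w :* (x :* y :* b) := x :* (w :* (y :* b))) refl W (p ^ λ′) (p ^ δ) b′) ⟩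
        ∣ p ^ λ′ * a - p ^ λ′ * (W * (p ^ δ * b′)) ∣      ≡⟨ sym (*-distribˡ-∣-∣ (p ^ λ′) a (W * (p ^ δ * b′))) ⟩
        p ^ λ′ * ∣ a - W * (p ^ δ * b′) ∣                 ∎
        where open ≡-Reasoning

      p∣p^δ : ∀ δ → 0 < δ → p ∣ p ^ δ
      p∣p^δ δ δ>0 = subst (λ x → p ∣ p ^ x) (suc-pred δ {{>-nonZero δ>0}}) (p∣p^[1+i] (pred δ))

      exact-valuation : p ^ (β + t) ∣ D → β ≡ λ′ × p ^ t ∣ ∣ a - W * b′ ∣
      exact-valuation h with <-cmp β λ′
      ... | tri≈ _ β≡λ _ = β≡λ , *-cancelˡ-∣ (p ^ β) {{m^n≢0 p β}}
            (subst₂ _∣_ (^-distribˡ-+-* p β t) (trans (D≡ 0 (trans (+-identityʳ β) β≡λ)) (cong (λ x → p ^ β * ∣ x - W * b′ ∣) (*-identityˡ a))) h)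
      ... | tri< β<λ _ _ = contradiction (∣∣x-y∣∧∣x⇒∣y (p ^ δ * a) (W * b′) (∣-trans (p∣p^[1+i] t′) p^t∣)
                                           (∣m⇒∣m*n a (p∣p^δ δ (m<n⇒0<n∸m β<λ)))) (¬∣-* ¬p∣W ¬p∣b′)
        where
        δ : ℕ
        δ = λ′ ∸ β

        p^t∣ : p ^ t ∣ ∣ p ^ δ * a - W * b′ ∣
        p^t∣ = *-cancelˡ-∣ (p ^ β) {{m^n≢0 p β}} (subst₂ _∣_ (^-distribˡ-+-* p β t) (D≡ δ (m+[n∸m]≡n (<⇒≤ β<λ))) h)
      ... | tri> _ _ λ<β = contradiction (≤-trans (s≤s (m≤m+n β t′)) (≤-trans (≤-reflexive (sym (+-suc β t′))) (≤-trans β+t≤λ (<⇒≤ λ<β))))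
                                         (<-irrefl refl)
        where
        δ : ℕ
        δ = β ∸ λ′

        ¬p∣a : ¬ p ∣ a
        ¬p∣a p∣a = p∣label-numerator⇒¬p∣denominator lab p∣a
          (subst (p ∣_) (sym b≡) (∣m⇒∣m*n b′ (p∣p^δ β (≤-trans (s≤s z≤n) λ<β))))
        ¬p∣rest : ¬ p ∣ ∣ a - W * (p ^ δ * b′) ∣
        ¬p∣rest p∣ = ¬p∣a (∣∣x-y∣∧∣y⇒∣x a (W * (p ^ δ * b′)) p∣ (∣n⇒∣m*n W (∣m⇒∣m*n b′ (p∣p^δ δ (m<n⇒0<n∸m λ<β)))))
        β+t≤λ : β + t ≤ λ′
        β+t≤λ = p^i∣p^j*c⇒i≤j ¬p∣rest (β + t) λ′ (subst (p ^ (β + t) ∣_) (D≡′ δ (m+[n∸m]≡n (<⇒≤ λ<β))) h)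

      exact-valuation⁻¹ : β ≡ λ′ × p ^ t ∣ ∣ a - W * b′ ∣ → p ^ (β + t) ∣ D
      exact-valuation⁻¹ (β≡λ , h) = subst₂ _∣_ (sym (^-distribˡ-+-* p β t))
        (sym (trans (D≡ 0 (trans (+-identityʳ β) β≡λ)) (cong (λ x → p ^ β * ∣ x - W * b′ ∣) (*-identityˡ a)))) (*-monoʳ-∣ (p ^ β) h)

      β≡λ⇔ : β ≡ λ′ ⇔ (p ^ λ′ ∣ b × ¬ p ^ suc λ′ ∣ b)
      β≡λ⇔ = mk⇔
        (λ β≡λ → subst (p ^ λ′ ∣_) (sym b≡) (p^i∣p^j*c b′ (≤-reflexive (sym β≡λ)))
               , λ h → <-irrefl refl (≤-trans (p^i∣p^j*c⇒i≤j ¬p∣b′ (suc λ′) β (subst (p ^ suc λ′ ∣_) b≡ h)) (≤-reflexive β≡λ)))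
        (λ (h₁ , h₂) → ≤-antisym (≮⇒≥ (λ λ<β → h₂ (subst (p ^ suc λ′ ∣_) (sym b≡) (p^i∣p^j*c b′ λ<β))))
                                 (p^i∣p^j*c⇒i≤j ¬p∣b′ λ′ β (subst (p ^ λ′ ∣_) b≡ h₁)))

      [b%M]/p^λ≡ : β ≡ λ′ → (b % M) / p ^ λ′ ≡ b′ % p ^ t
      [b%M]/p^λ≡ β≡λ = begin
        (b % M) / p ^ λ′                               ≡⟨ cong (λ x → (x % M) / p ^ λ′) (trans b≡ (trans (cong (λ y → p ^ y * b′) β≡λ) (*-comm (p ^ λ′) b′))) ⟩
        ((b′ * p ^ λ′) % M) / p ^ λ′                   ≡⟨ cong (_/ p ^ λ′) (%-congʳ (trans M≡p^λ*p^t (*-comm (p ^ λ′) (p ^ t)))) ⟩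
        ((b′ * p ^ λ′) % (p ^ t * p ^ λ′)) / p ^ λ′    ≡⟨ cong (_/ p ^ λ′) (sym (m%n*o≡m*o%[n*o] b′ (p ^ t) (p ^ λ′))) ⟩
        (b′ % p ^ t * p ^ λ′) / p ^ λ′                 ≡⟨ m*n/n≡m (b′ % p ^ t) (p ^ λ′) ⟩
        b′ % p ^ t                                     ∎
        where open ≡-Reasoning

      residue≡ : β ≡ λ′ → (W * ((b % M) / p ^ λ′)) % p ^ t ≡ (W * b′) % p ^ t
      residue≡ β≡λ = trans (cong (λ x → (W * x) % p ^ t) ([b%M]/p^λ≡ β≡λ)) (%-distribʳ-* W b′ (p ^ t))

      a%M%p^t≡ : (a % M) % p ^ t ≡ a % p ^ t
      a%M%p^t≡ = m∣n⇒o%n%m≡o%m (p ^ t) M a p^t∣M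

      to-residues : β ≡ λ′ × p ^ t ∣ ∣ a - W * b′ ∣ →
        p ^ λ′ ∣ b % M × ¬ p ^ suc λ′ ∣ b % M × (a % M) % p ^ t ≡ (W * ((b % M) / p ^ λ′)) % p ^ t
      to-residues (β≡λ , h) =
          %-presˡ-∣ (proj₁ (Equivalence.to β≡λ⇔ β≡λ)) p^λ∣M
        , proj₂ (Equivalence.to β≡λ⇔ β≡λ) ∘ ∣n∣m%n⇒∣m p^[1+λ]∣M
        , trans a%M%p^t≡ (trans (Equivalence.to (M∣∣x-y∣⇔%≡% a (W * b′) (p ^ t)) h) (sym (residue≡ β≡λ)))

      from-residues : p ^ λ′ ∣ b % M × ¬ p ^ suc λ′ ∣ b % M × (a % M) % p ^ t ≡ (W * ((b % M) / p ^ λ′)) % p ^ t →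
        β ≡ λ′ × p ^ t ∣ ∣ a - W * b′ ∣
      from-residues (h₁ , h₂ , h₃) = β≡λ , Equivalence.from (M∣∣x-y∣⇔%≡% a (W * b′) (p ^ t)) (trans (sym a%M%p^t≡) (trans h₃ (residue≡ β≡λ)))
        where β≡λ = Equivalence.from β≡λ⇔ (∣n∣m%n⇒∣m p^λ∣M h₁ , h₂ ∘ λ h → %-presˡ-∣ h p^[1+λ]∣M)

    criterion : ∀ a b → CWLabel (a , b) → OrdDiffGe p z ν (a , b) ⇔ (Q (a % M , b % M) ≡ true)
    criterion a (suc b₀) lab = begin
      OrdDiffGe p z ν (a , b)                                                ≈⟨ ordDiffGe⇔ a b₀ sb ⟩
      p ^ (β + posPart m) ∣ ∣ p ^ k * a - T * b ∣ * p ^ negPart m            ≈⟨ cancel-p^j ⟩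
      p ^ (β + t) ∣ D                                                        ≈⟨ mk⇔ exact-valuation exact-valuation⁻¹ ⟩
      (β ≡ λ′ × p ^ t ∣ ∣ a - W * b′ ∣)                                      ≈⟨ mk⇔ to-residues from-residues ⟩
      (p ^ λ′ ∣ b % M × ¬ p ^ suc λ′ ∣ b % M × (a % M) % p ^ t ≡ (W * ((b % M) / p ^ λ′)) % p ^ t) ≈⟨ ⇔-sym (Q≡true⇔ (a % M) (b % M)) ⟩
      Q (a % M , b % M) ≡ true                                               ∎
      where
      open Label a b₀ lab
      open ⇔-Reasoning

    exact : ℕ → ℕ
    exact b = 𝟙 (does (p ^ λ′ ∣? b)) * 𝟙 (not (does (p ^ suc λ′ ∣? b)))

    target : ℕ → ℕ
    target b = (W * (b / p ^ λ′)) % p ^ t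

    𝟙-Q : ∀ a b → 𝟙 (Q (a , b)) ≡ exact b * 𝟙 (does (a % p ^ t ≟ target b))
    𝟙-Q a b = trans (𝟙-∧ (does (p ^ λ′ ∣? b)) _) (trans (cong (𝟙 (does (p ^ λ′ ∣? b)) *_) (𝟙-∧ (not (does (p ^ suc λ′ ∣? b))) _))
                (sym (*-assoc (𝟙 (does (p ^ λ′ ∣? b))) _ _)))

    Q⇒primitive? : ∀ a b → Q (a , b) ≡ true → primitive? (a , b) ≡ true
    Q⇒primitive? a b Q≡true = cong (λ x → not (x ∧ does (p ∣? b))) (dec-false (p ∣? a) ¬p∣a)
      where
      parts : p ^ λ′ ∣ b × ¬ p ^ suc λ′ ∣ b × a % p ^ t ≡ target b
      parts = Equivalence.to (Q≡true⇔ a b) Q≡true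

      c : ℕ
      c = b / p ^ λ′

      ¬p∣c : ¬ p ∣ c
      ¬p∣c p∣c = proj₁ (proj₂ parts) (subst (p ^ suc λ′ ∣_) (m/n*n≡m (proj₁ parts)) (*-monoˡ-∣ (p ^ λ′) p∣c))
      p∣p^t : p ∣ p ^ t
      p∣p^t = p∣p^[1+i] t′

      ¬p∣a : ¬ p ∣ a
      ¬p∣a p∣a = ¬∣-* ¬p∣W ¬p∣c (∣n∣m%n⇒∣m p∣p^t (subst (p ∣_) (proj₂ (proj₂ parts)) (%-presˡ-∣ p∣a p∣p^t)))

    #residue-class : ∀ c → c < p ^ t → ∑[ a < M ] 𝟙 (does (a % p ^ t ≟ c)) ≡ p ^ λ′
    #residue-class c c<p^t = begin
      ∑[ a < M ] 𝟙 (does (a % p ^ t ≟ c))                                  ≡⟨ cong (λ n → ∑[ a < n ] 𝟙 (does (a % p ^ t ≟ c))) M≡p^λ*p^t ⟩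
      ∑[ a < p ^ λ′ * p ^ t ] 𝟙 (does (a % p ^ t ≟ c))                     ≡⟨ ∑-blocks (p ^ λ′) (p ^ t) _ ⟩
      ∑[ i < p ^ λ′ ] ∑[ r < p ^ t ] 𝟙 (does ((i * p ^ t + r) % p ^ t ≟ c))
        ≡⟨ ∑-cong (p ^ λ′) (λ i _ → trans (∑-cong (p ^ t) (λ r r< → cong (λ x → 𝟙 (does (x ≟ c)))
             (trans (%-remove-+ˡ r (divides i refl)) (m<n⇒m%n≡m r<)))) (∑-𝟙-≡ (p ^ t) c c<p^t)) ⟩
      ∑[ _ < p ^ λ′ ] 1                                                    ≡⟨ trans (∑-const (p ^ λ′) 1) (*-identityʳ _) ⟩
      p ^ λ′                                                               ∎
      where open ≡-Reasoning

    -- Among the b < M, those of valuation exactly λ are p^λ i with p ∤ i < p^t.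
    #exact+p^t′≡p^t : ∑ M exact + p ^ t′ ≡ p ^ t
    #exact+p^t′≡p^t = begin
      ∑ M exact + p ^ t′                                            ≡⟨ cong (λ n → ∑ n exact + p ^ t′) (trans M≡p^λ*p^t (*-comm (p ^ λ′) (p ^ t))) ⟩
      ∑ (p ^ t * p ^ λ′) exact + p ^ t′                             ≡⟨ cong (_+ p ^ t′) (∑-blocks (p ^ t) (p ^ λ′) exact) ⟩
      ∑[ i < p ^ t ] ∑[ r < p ^ λ′ ] exact (i * p ^ λ′ + r) + p ^ t′ ≡⟨ cong (_+ p ^ t′) (∑-cong (p ^ t) (λ i _ → block i)) ⟩
      ∑[ i < p ^ t ] 𝟙 (not (does (p ∣? i))) + p ^ t′               ≡⟨ cong (λ n → ∑[ i < n ] 𝟙 (not (does (p ∣? i))) + p ^ t′) (*-comm p (p ^ t′)) ⟩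
      ∑[ i < p ^ t′ * p ] 𝟙 (not (does (p ∣? i))) + p ^ t′          ≡⟨ ∑-𝟙-∤+q≡q*p (p ^ t′) p ⟩
      p ^ t′ * p                                                    ≡⟨ *-comm (p ^ t′) p ⟩
      p ^ t                                                         ∎
      where
      open ≡-Reasoning

      block : ∀ i → ∑[ r < p ^ λ′ ] exact (i * p ^ λ′ + r) ≡ 𝟙 (not (does (p ∣? i)))
      block i = begin
        ∑[ r < p ^ λ′ ] exact (i * p ^ λ′ + r)
          ≡⟨ ∑-cong (p ^ λ′) (λ r r< → trans (cong (λ x → 𝟙 x * 𝟙 (not (does (p ^ suc λ′ ∣? (i * p ^ λ′ + r)))))
               (does-⇔ (r∣i*r+j⇔j≡0 i (p ^ λ′) r r<) (p ^ λ′ ∣? (i * p ^ λ′ + r)) (r ≟ 0))) (*-comm (𝟙 (does (r ≟ 0))) _)) ⟩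
        ∑[ r < p ^ λ′ ] (𝟙 (not (does (p ^ suc λ′ ∣? (i * p ^ λ′ + r)))) * 𝟙 (does (r ≟ 0)))
          ≡⟨ ∑-at-0 (p ^ λ′) (λ r → 𝟙 (not (does (p ^ suc λ′ ∣? (i * p ^ λ′ + r))))) (m^n>0 p λ′) ⟩
        𝟙 (not (does (p ^ suc λ′ ∣? (i * p ^ λ′ + 0))))
          ≡⟨ cong (λ x → 𝟙 (not x)) (does-⇔ (mk⇔
               (λ h → *-cancelʳ-∣ (p ^ λ′) (subst (p * p ^ λ′ ∣_) (+-identityʳ (i * p ^ λ′)) h))
               (λ h → subst (p * p ^ λ′ ∣_) (sym (+-identityʳ (i * p ^ λ′))) (*-monoˡ-∣ (p ^ λ′) h)))
               (p ^ suc λ′ ∣? (i * p ^ λ′ + 0)) (p ∣? i)) ⟩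
        𝟙 (not (does (p ∣? i)))                                     ∎

    total+p^K≡M : Hitting.total Q 0 + p ^ (l + t) ≡ M
    total+p^K≡M = begin
      total 0 + p ^ (l + t)                         ≡⟨ cong₂ _+_ total≡ p^K≡ ⟩
      ∑ M exact * p ^ λ′ + p ^ λ′ * p ^ t′          ≡⟨ solve 3 (λ s x y → s :* x :+ x :* y := x :* (s :+ y)) refl (∑ M exact) (p ^ λ′) (p ^ t′) ⟩
      p ^ λ′ * (∑ M exact + p ^ t′)                 ≡⟨ cong (p ^ λ′ *_) #exact+p^t′≡p^t ⟩
      p ^ λ′ * p ^ t                                ≡⟨ sym M≡p^λ*p^t ⟩
      M                                             ∎
      where
      open Hitting Q
      open ≡-Reasoning

      p^K≡ : p ^ (l + t) ≡ p ^ λ′ * p ^ t′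
      p^K≡ = trans (cong (p ^_) (+-suc l t′)) (^-distribˡ-+-* p λ′ t′)

      term : ∀ a b → 𝟙 (primitive? (a , b)) * 𝟙 (Q (a , b)) ≡ exact b * 𝟙 (does (a % p ^ t ≟ target b))
      term a b with Q (a , b) in eq
      ... | false = trans (*-zeroʳ (𝟙 (primitive? (a , b)))) (trans (cong 𝟙 (sym eq)) (𝟙-Q a b))
      ... | true  = trans (cong (λ x → 𝟙 x * 1) (Q⇒primitive? a b eq)) (trans (cong 𝟙 (sym eq)) (𝟙-Q a b))

      total≡ : total 0 ≡ ∑ M exact * p ^ λ′
      total≡ = begin
        total 0                                                         ≡⟨ ∑²-cong (λ a b _ _ → term a b) ⟩
        ∑[ a < M ] ∑[ b < M ] (exact b * 𝟙 (does (a % p ^ t ≟ target b))) ≡⟨ ∑-swap M M _ ⟩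
        ∑[ b < M ] ∑[ a < M ] (exact b * 𝟙 (does (a % p ^ t ≟ target b)))
          ≡⟨ ∑-cong M (λ b _ → trans (∑-distribˡ-* M (exact b) (λ a → 𝟙 (does (a % p ^ t ≟ target b))))
                (cong (exact b *_) (#residue-class (target b) (m%n<n _ (p ^ t))))) ⟩
        ∑[ b < M ] (exact b * p ^ λ′)                                   ≡⟨ ∑-distribʳ-* M (p ^ λ′) exact ⟩
        ∑ M exact * p ^ λ′                                              ∎

  HasOrd-unique : ∀ {p} (z : Qp p) {o o′} → HasOrd z o → HasOrd z o′ → o ≡ o′
  HasOrd-unique z (j , o≡ , tj≡0 , tj+1≢0) (j′ , o′≡ , tj′≡0 , tj′+1≢0) =
    trans o≡ (trans (cong (λ i → ℤ.+ i ℤ.- ℤ.+ shift z) (first-nonzero-unique (digits z) j j′ tj≡0 tj+1≢0 tj′≡0 tj′+1≢0)) (sym o′≡))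

  InZp∧HasOrd⇒0≤ord : ∀ {p} (z : Qp p) {o} → InZp z → HasOrd z o → ℤ.+ 0 ℤ.≤ o
  InZp∧HasOrd⇒0≤ord z z∈ℤp (j , o≡ , _ , tj+1≢0) = subst (ℤ.+ 0 ℤ.≤_) (sym (trans o≡ (trans (ℤP.[+m]-[+n]≡m⊖n j (shift z)) (ℤP.⊖-≥ k≤j))))
    (ℤ.+≤+ z≤n)
    where
    k≤j : shift z ≤ j
    k≤j = ≮⇒≥ (λ j<k → tj+1≢0 (n≤0⇒n≡0 (subst (trunc (digits z) (suc j) ≤_) z∈ℤp (trunc-mono-≤ (digits z) j<k))))

  0<ν⇒ν≡1+ : ∀ {ν} → ℤ.+ 0 ℤ.< ν → ∃ λ K → ν ≡ ℤ.+ suc K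
  0<ν⇒ν≡1+ {ℤ.+ suc K} _ = K , refl
  0<ν⇒ν≡1+ {ℤ.+ zero} (ℤ.+<+ ())

  -[1+l]≡j-k⇒k≡j+1+l : ∀ j k l → -[1+ l ] ≡ ℤ.+ j ℤ.- ℤ.+ k → k ≡ j + suc l
  -[1+l]≡j-k⇒k≡j+1+l j k l eq = ℤP.+-injective (begin
    ℤ.+ k                                       ≡⟨ sym (ℤP.+-identityʳ (ℤ.+ k)) ⟩
    ℤ.+ k ℤ.+ ℤ.+ 0                             ≡⟨ cong (λ x → ℤ.+ k ℤ.+ x) (sym (ℤP.+-inverseˡ (ℤ.+ suc l))) ⟩
    ℤ.+ k ℤ.+ (-[1+ l ] ℤ.+ ℤ.+ suc l)          ≡⟨ cong (λ x → ℤ.+ k ℤ.+ (x ℤ.+ ℤ.+ suc l)) eq ⟩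
    ℤ.+ k ℤ.+ (ℤ.+ j ℤ.- ℤ.+ k ℤ.+ ℤ.+ suc l)   ≡⟨ ℤsolve 3 (λ k j l → k ⊕ (j ⊝ k ⊕ l) ⊜ j ⊕ l) refl (ℤ.+ k) (ℤ.+ j) (ℤ.+ suc l) ⟩
    ℤ.+ j ℤ.+ ℤ.+ suc l                         ∎)
    where
    open ≡-Reasoning
    open ℤSolver.+-*-Solver using () renaming (solve to ℤsolve; _:+_ to _⊕_; _:-_ to _⊝_; _:=_ to _⊜_)

  -[1+l]<ν⇒ν+1+l≡1+ : ∀ ν l → -[1+ l ] ℤ.< ν → ∃ λ t′ → ν ℤ.+ ℤ.+ suc l ≡ ℤ.+ suc t′
  -[1+l]<ν⇒ν+1+l≡1+ (ℤ.+ n)   l _              = n + l , cong ℤ.+_ (+-suc n l)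
  -[1+l]<ν⇒ν+1+l≡1+ -[1+ n ] l (ℤ.-<- n<l) = l ∸ suc n , trans (ℤP.⊖-≥ (<⇒≤ (s≤s n<l))) (cong ℤ.+_ (+-∸-assoc 1 n<l))

  ν+a≡t⇒ν+[j+a]≡j+t : ∀ ν a j t → ν ℤ.+ ℤ.+ a ≡ ℤ.+ t → ν ℤ.+ ℤ.+ (j + a) ≡ ℤ.+ (j + t)
  ν+a≡t⇒ν+[j+a]≡j+t ν a j t eq = begin
    ν ℤ.+ ℤ.+ (j + a)       ≡⟨ cong (λ x → ν ℤ.+ x) (trans (cong ℤ.+_ (+-comm j a)) (ℤP.pos-+ a j)) ⟩
    ν ℤ.+ (ℤ.+ a ℤ.+ ℤ.+ j) ≡⟨ sym (ℤP.+-assoc ν (ℤ.+ a) (ℤ.+ j)) ⟩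
    ν ℤ.+ ℤ.+ a ℤ.+ ℤ.+ j   ≡⟨ cong (ℤ._+ ℤ.+ j) eq ⟩
    ℤ.+ t ℤ.+ ℤ.+ j         ≡⟨ cong ℤ.+_ (+-comm t j) ⟩
    ℤ.+ (j + t)             ∎
    where open ≡-Reasoning

  IsZero⇒InZp : ∀ {p} (z : Qp p) → IsZero z → InZp z
  IsZero⇒InZp z z≡0 = trunc-≡0 (digits z) z≡0 (shift z)

  integral-case : ∀ p (p-prime : Prime p) K (z : Qp p) → InZp z →
    ConvergesTo (Fseq p z (ℤ.+ suc K)) (cwVal p {{prime⇒nonZero p-prime}} (ℤ.+ suc K))
  integral-case p p-prime K z z∈ℤp = subst (ConvergesTo (Fseq p z (ℤ.+ suc K)))
    (density≡cwVal (Hitting.total Q 0) total+p^K≡M) (Fseq-converges z (ℤ.+ suc K) Q criterion)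
    where
    open PrimePower p p-prime K
    open IntegralCase p p-prime z K z∈ℤp

  fractional-case : ∀ p (p-prime : Prime p) z l ν → ¬ InZp z → HasOrd z -[1+ l ] → OrdLt z ν ⊎ IsZero z →
    ConvergesTo (Fseq p z ν) (cwVal p {{prime⇒nonZero p-prime}} (ν ℤ.+ ℤ.+ (2 * suc l)))
  fractional-case p p-prime z l ν z∉ℤp _ (inj₂ z≡0) = contradiction (IsZero⇒InZp z z≡0) z∉ℤp
  fractional-case p p-prime z l ν _ ord@(j , ord≡ , tj≡0 , tj+1≢0) (inj₁ (o , ord′ , o<ν)) =
    subst (ConvergesTo (Fseq p z ν))
      (trans (density≡cwVal (Hitting.total Q 0) total+p^K≡M) (cong (cwVal p {{prime⇒nonZero p-prime}}) (sym ν+2λ≡)))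
      (Fseq-converges z ν Q criterion)
    where
    k≡j+λ : shift z ≡ j + suc l
    k≡j+λ = -[1+l]≡j-k⇒k≡j+1+l j (shift z) l ord≡
    t′,ν+λ≡t : ∃ λ t′ → ν ℤ.+ ℤ.+ suc l ≡ ℤ.+ suc t′
    t′,ν+λ≡t = -[1+l]<ν⇒ν+1+l≡1+ ν l (subst (ℤ._< ν) (HasOrd-unique z ord′ ord) o<ν)
    t′ : ℕ
    t′ = proj₁ t′,ν+λ≡t

    m≡j+t : ν ℤ.+ ℤ.+ shift z ≡ ℤ.+ (j + suc t′)
    m≡j+t = trans (cong (λ x → ν ℤ.+ ℤ.+ x) k≡j+λ) (ν+a≡t⇒ν+[j+a]≡j+t ν (suc l) j (suc t′) (proj₂ t′,ν+λ≡t))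

    ν+2λ≡ : ν ℤ.+ ℤ.+ (2 * suc l) ≡ ℤ.+ suc (l + suc t′)
    ν+2λ≡ = trans (cong (λ x → ν ℤ.+ ℤ.+ (suc l + x)) (+-identityʳ (suc l)))
                  (ν+a≡t⇒ν+[j+a]≡j+t ν (suc l) (suc l) (suc t′) (proj₂ t′,ν+λ≡t))
    open PrimePower p p-prime (l + suc t′)
    open FractionalCase p p-prime z l t′ j ν k≡j+λ m≡j+t tj≡0 tj+1≢0

  zero-case : ∀ p (p-prime : Prime p) (z : Qp p) ν′ → IsZero z →
    ConvergesTo (Fseq p z (ℤ.- ℤ.+ ν′)) (1ℚ ℚ.- cwVal p {{prime⇒nonZero p-prime}} (ℤ.+ ν′ ℤ.+ ℤ.+ 1))
  zero-case p p-prime z ν′ z≡0 = subst (ConvergesTo (Fseq p z (ℤ.- ℤ.+ ν′)))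
    (density≡1-cwVal (Hitting.total Q 0) total+M≡#primitive+p^ν′) (Fseq-converges z (ℤ.- ℤ.+ ν′) Q criterion)
    where
    open PrimePower p p-prime ν′
    open ZeroCase p p-prime z ν′ z≡0

  integral⇒0<ν : ∀ {p} (z : Qp p) ν → OrdLt z ν ⊎ IsZero z → InZp z → (IsZero z → ℤ.+ 1 ℤ.≤ ν) → ℤ.+ 0 ℤ.< ν
  integral⇒0<ν z ν (inj₁ (o , ord , o<ν)) z∈ℤp _      = ℤP.≤-<-trans (InZp∧HasOrd⇒0≤ord z z∈ℤp ord) o<ν
  integral⇒0<ν z ν (inj₂ z≡0)            _    1≤ν = ℤP.<-≤-trans (ℤ.+<+ z<s) (1≤ν z≡0)

open import Data.Nat using (ℕ; suc; _<_)
open import Data.Nat.Primality using (Prime; prime⇒nonZero)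
open import Data.Integer using (ℤ; +_; -_; _≤_)
open import Data.Rational using (1ℚ; _-_)
open import Data.Product using (_×_; _,_)
open import Data.Sum using (_⊎_; inj₁; inj₂)
open import Relation.Nullary using (¬_; contradiction)
open import Relation.Binary.PropositionalEquality using (_≡_; refl)

theorem10 : (p : ℕ) → (pp : Prime p) → (ν : ℤ) → (z : Qp p) →
  (OrdLt z ν ⊎ IsZero z) →
  -- (i) z ∈ ℤ_p (and ν ≥ 1 when z = 0)
  ((InZp z → (IsZero z → + 1 ≤ ν) →
      ConvergesTo (Fseq p z ν) (cwVal p {{prime⇒nonZero pp}} ν))
  -- (ii) z ∉ ℤ_p with ord_p z = -λ < 0
  × ((λ' : ℕ) → 0 < λ' → ¬ InZp z → HasOrd z (- (+ λ')) →
      ConvergesTo (Fseq p z ν)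
        (cwVal p {{prime⇒nonZero pp}} (ν Data.Integer.+ + (2 Data.Nat.* λ'))))
  -- (iii) z = 0 and ν = -ν' with ν' ≥ 0
  × (IsZero z → (ν' : ℕ) → ν ≡ - (+ ν') →
      ConvergesTo (Fseq p z ν)
        (1ℚ - cwVal p {{prime⇒nonZero pp}} (+ ν' Data.Integer.+ + 1))))
theorem10 p pp ν z ord<ν⊎z≡0 = integral , fractional , λ { z≡0 ν′ refl → zero-case p pp z ν′ z≡0 }
  where
  integral : InZp z → (IsZero z → + 1 ≤ ν) → ConvergesTo (Fseq p z ν) (cwVal p {{prime⇒nonZero pp}} ν)
  integral z∈ℤp 1≤ν-if-0 with 0<ν⇒ν≡1+ (integral⇒0<ν z ν ord<ν⊎z≡0 z∈ℤp 1≤ν-if-0)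
  ... | K , refl = integral-case p pp K z z∈ℤp
  fractional : (λ' : ℕ) → 0 < λ' → ¬ InZp z → HasOrd z (- (+ λ')) →
    ConvergesTo (Fseq p z ν) (cwVal p {{prime⇒nonZero pp}} (ν Data.Integer.+ + (2 Data.Nat.* λ')))
  fractional (suc l) _ z∉ℤp ord = fractional-case p pp z l ν z∉ℤp ord ord<ν⊎z≡0
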